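{- Let $0<1/n\ll\mu\ll p$. Let $G$ be an $n$-vertex Steiner triple system with a singleton-pair partition $\mathcal U$ of $V(G)$, and let $X\sim\mathcal U_p$. Then with probability $1-o(1/n)$ the following holds: for every pair of distinct vertices $u,v\in V(G)$, there exist at least $\mu n$ internally vertex-disjoint $u$--$v$ paths of length $3$ in $G$ all of whose internal vertices lie in $X$.
   Context: A Steiner triple system is a $3$-uniform hypergraph in which every pair of distinct vertices lies in exactly one edge. A singleton-pair partition of $V(G)$ is a partition $\{U_1,\dots,U_m\}$ of $V(G)$ with $|U_i|\le 2$ for all $i$. For $p\in[0,1]$, $\mathcal U_p$ is the random subfamily of $\mathcal U$ obtained by including each $U_i$ independently with probability $p$, and $X\sim\mathcal U_p$ means $X=\bigcup_{U\in\mathcal U_p}U$. A path of length $\ell$ in a linear $3$-graph consists of distinct vertices $v_0,\dots,v_\ell,u_1,\dots,u_\ell$ and edges $\{v_i,u_{i+1},v_{i+1}\}$, $i=0,\dots,\ell-1$; its end pairs are $\{v_0,u_1\}$ and $\{u_\ell,v_\ell\}$. A $u$--$v$ path is such a path with specified end vertices $u,v$ taken one from each end pair; the remaining vertices are internal. Two $u$--$v$ paths are internally vertex-disjoint if their vertex sets intersect only in $\{u,v\}$. The hierarchy $0<1/n\ll\mu\ll p$ means there are functions $f,g$ such that the statement holds whenever $\mu\le f(p)$ and $1/n\le g(\mu)$; the $o(1/n)$ term is as $n\to\infty$.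
   Formalization: The parameters p and μ, the tolerance bounding the $o(1/n)$ term, and the arguments and values of the function f in the hierarchy are all rational. -}

module Defs where

open import Data.Nat using (ℕ; zero; suc; _∸_)
open import Data.Integer using (+_)
open import Data.Fin using (Fin)
open import Data.Fin.Subset using (Subset; ⁅_⁆; _∪_; _∩_; _∈_; ∣_∣) renaming (⊥ to ∅)
open import Data.Rational using (ℚ; _/_; _*_; _+_; _-_; 0ℚ; 1ℚ; _≤_; _<_)
open import Data.List using (List; []; _∷_; map; foldr)
open import Data.List.Membership.Propositional using () renaming (_∈_ to _∈ₗ_)
open import Data.List.Relation.Unary.Unique.Propositional using (Unique)
open import Data.Product using (Σ; ∃; ∃-syntax; _×_; _,_)
open import Data.Sum using (_⊎_)
open import Data.Empty using (⊥)
open import Relation.Nullary using (¬_)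
open import Relation.Binary.PropositionalEquality using (_≡_; _≢_)

ℕtoℚ : ℕ → ℚ
ℕtoℚ n = + n / 1

_^ℚ_ : ℚ → ℕ → ℚ
q ^ℚ zero  = 1ℚ
q ^ℚ suc k = q * (q ^ℚ k)

sumℚ : List ℚ → ℚ
sumℚ = foldr _+_ 0ℚ

record Hypergraph3 (n : ℕ) : Set₁ where
  field
    Edge     : Subset n → Set
    uniform3 : ∀ e → Edge e → ∣ e ∣ ≡ 3
open Hypergraph3 public

triple : ∀ {n} → Fin n → Fin n → Fin n → Subset n
triple a b c = ⁅ a ⁆ ∪ (⁅ b ⁆ ∪ ⁅ c ⁆)

IsSTS : ∀ {n} → Hypergraph3 n → Set
IsSTS {n} G =
  ∀ (x y : Fin n) → x ≢ y →
    Σ (Subset n) λ e → (Edge G e × x ∈ e × y ∈ e) ×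
      (∀ e' → Edge G e' → x ∈ e' → y ∈ e' → e' ≡ e)

record SingletonPairPartition (n : ℕ) : Set where
  field
    m        : ℕ
    block    : Fin m → Subset n
    nonempty : ∀ i → 1 Data.Nat.≤ ∣ block i ∣
    small    : ∀ i → ∣ block i ∣ Data.Nat.≤ 2
    disjoint : ∀ i j → i ≢ j → block i ∩ block j ≡ ∅
    covers   : ∀ (x : Fin n) → ∃[ i ] x ∈ block i
open SingletonPairPartition public

-- X = union of the selected blocks (S ⊆ blocks is the outcome of 𝒰_p)
InX : ∀ {n} (𝒰 : SingletonPairPartition n) → Subset (m 𝒰) → Fin n → Set
InX 𝒰 S x = ∃[ i ] (i ∈ S × x ∈ block 𝒰 i)

-- probability of outcome S under 𝒰_p (each block kept independently w.p. p)
weight : ∀ {m} → ℚ → Subset m → ℚ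
weight {m} p S = (p ^ℚ ∣ S ∣) * ((1ℚ - p) ^ℚ (m ∸ ∣ S ∣))

-- Paths of length 3: distinct v0,v1,v2,v3,u1,u2,u3 and edges
-- {v0,u1,v1}, {v1,u2,v2}, {v2,u3,v3}; end pairs {v0,u1}, {u3,v3}.

record Path3 {n : ℕ} (G : Hypergraph3 n) : Set where
  field
    v0 v1 v2 v3 u1 u2 u3 : Fin n
    distinct : Unique (v0 ∷ v1 ∷ v2 ∷ v3 ∷ u1 ∷ u2 ∷ u3 ∷ [])
    edge1    : Edge G (triple v0 u1 v1)
    edge2    : Edge G (triple v1 u2 v2)
    edge3    : Edge G (triple v2 u3 v3)

  vertices : List (Fin n)
  vertices = v0 ∷ v1 ∷ v2 ∷ v3 ∷ u1 ∷ u2 ∷ u3 ∷ []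
open Path3 public

record UVPath3 {n : ℕ} (G : Hypergraph3 n) (u v : Fin n) : Set where
  field
    path  : Path3 G
    endU  : (u ≡ v0 path) ⊎ (u ≡ u1 path)
    endV  : (v ≡ u3 path) ⊎ (v ≡ v3 path)
open UVPath3 public

Internal : ∀ {n} {G : Hypergraph3 n} {u v : Fin n} → UVPath3 G u v → Fin n → Set
Internal {u = u} {v = v} P x = x ∈ₗ vertices (path P) × x ≢ u × x ≢ v

InternallyDisjoint : ∀ {n} {G : Hypergraph3 n} {u v : Fin n} →
                     UVPath3 G u v → UVPath3 G u v → Set
InternallyDisjoint P Q = ∀ x → Internal P x → Internal Q x → ⊥

GoodEvent : ∀ {n} → Hypergraph3 n → (𝒰 : SingletonPairPartition n) → ℚ →
            Subset (m 𝒰) → Set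
GoodEvent {n} G 𝒰 μ S =
  ∀ (u v : Fin n) → u ≢ v →
    Σ ℕ λ k → (μ * ℕtoℚ n ≤ ℕtoℚ k) ×
      Σ (Fin k → UVPath3 G u v) λ P →
        (∀ i j → i ≢ j → InternallyDisjoint (P i) (P j)) ×
        (∀ i x → Internal (P i) x → InX 𝒰 S x)

-- P[ not GoodEvent ] ≤ ε / n, written as n · P[ not GoodEvent ] ≤ ε:
-- some list of outcomes contains every bad outcome and has total
-- weight W with n · W ≤ ε (finite outer-probability bound)
FailureProbAtMostεOverN : ∀ {n} → Hypergraph3 n → (𝒰 : SingletonPairPartition n) →
                          ℚ → ℚ → ℚ → Set
FailureProbAtMostεOverN {n} G 𝒰 p μ ε =
  Σ (List (Subset (m 𝒰))) λ L →
    (∀ S → ¬ (S ∈ₗ L) → GoodEvent G 𝒰 μ S) ×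
    (ℕtoℚ n * sumℚ (map (weight p) L) ≤ ε)

{-# OPTIONS --safe #-}
module Submission where

-- Fix u ≠ v and write x · y for the third vertex of the edge through x and y. Any w₁, w₂ give the
-- u–v path u, w₁, w₂, v with middle vertices u · w₁, w₁ · w₂, w₂ · v, and choosing w₁, w₂ outside
-- the O(k) vertices used so far produces k = Θ(n) such paths whose interiors meet pairwise
-- disjoint sets of at most five blocks of 𝒰. Each path then lies in X with probability at least
-- p⁵, independently of the others, so the number Y of such paths satisfies
-- E[2^(-Y)] ≤ (1 - p⁵/2)^k and P(Y < s) ≤ 2^s (1 - p⁵/2)^k, which is exponentially small in n
-- for s = Θ(μ n). A union bound over the n² pairs then gives failure probability o(1/n).

open import Defs
open import Data.Nat using (ℕ)
import Data.Nat as ℕ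
open import Data.Rational using (ℚ; 0ℚ; 1ℚ)
import Data.Rational as ℚ

module RationalArithmetic where

  open import Algebra.Bundles using (CommutativeRing)
  open import Data.Nat as ℕ using (ℕ; zero; suc)
  import Data.Nat.Properties as ℕ
  open import Data.Nat.Coprimality using (1-coprimeTo)
  open import Data.Integer as ℤ using (+_; +[1+_]; -[1+_])
  import Data.Integer.Properties as ℤ
  open import Data.Rational
  open import Data.Rational.Properties
  import Data.Rational.Unnormalised as ℚᵘ
  import Data.Rational.Unnormalised.Properties as ℚᵘ
  open import Data.Rational.Solver using (module +-*-Solver)
  open import Data.Integer.Solver using () renaming (module +-*-Solver to ℤ-Solver)
  open import Data.Product using (_,_)
  open import Relation.Binary.PropositionalEquality
  import Algebra.Properties.CommutativeSemiring.Exp as Exp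

  private
    module E = Exp (CommutativeRing.commutativeSemiring +-*-commutativeRing)

    toℚᵘ-ℕtoℚ : ∀ n → toℚᵘ (ℕtoℚ n) ℚᵘ.≃ ℚᵘ.mkℚᵘ (+ n) 0
    toℚᵘ-ℕtoℚ n = toℚᵘ-fromℚᵘ (ℚᵘ.mkℚᵘ (+ n) 0)

  ℕtoℚ-+ : ∀ a b → ℕtoℚ (a ℕ.+ b) ≡ ℕtoℚ a + ℕtoℚ b
  ℕtoℚ-+ a b = toℚᵘ-injective (begin
    toℚᵘ (ℕtoℚ (a ℕ.+ b))                      ≈⟨ toℚᵘ-ℕtoℚ (a ℕ.+ b) ⟩
    ℚᵘ.mkℚᵘ (+ (a ℕ.+ b)) 0                    ≈⟨ ℚᵘ.*≡* numerators ⟩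
    ℚᵘ.mkℚᵘ (+ a) 0 ℚᵘ.+ ℚᵘ.mkℚᵘ (+ b) 0        ≈⟨ ℚᵘ.+-cong (toℚᵘ-ℕtoℚ a) (toℚᵘ-ℕtoℚ b) ⟨
    toℚᵘ (ℕtoℚ a) ℚᵘ.+ toℚᵘ (ℕtoℚ b)           ≈⟨ toℚᵘ-homo-+ (ℕtoℚ a) (ℕtoℚ b) ⟨
    toℚᵘ (ℕtoℚ a + ℕtoℚ b)                     ∎)
    where
    open ℚᵘ.≃-Reasoning
    numerators : + (a ℕ.+ b) ℤ.* + 1 ≡ (+ a ℤ.* + 1 ℤ.+ + b ℤ.* + 1) ℤ.* + 1
    numerators rewrite ℤ.*-identityʳ (+ a) | ℤ.*-identityʳ (+ b) = cong (ℤ._* + 1) (ℤ.pos-+ a b)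

  ℕtoℚ-* : ∀ a b → ℕtoℚ (a ℕ.* b) ≡ ℕtoℚ a * ℕtoℚ b
  ℕtoℚ-* a b = toℚᵘ-injective (begin
    toℚᵘ (ℕtoℚ (a ℕ.* b))                      ≈⟨ toℚᵘ-ℕtoℚ (a ℕ.* b) ⟩
    ℚᵘ.mkℚᵘ (+ (a ℕ.* b)) 0                    ≈⟨ ℚᵘ.*≡* (cong (ℤ._* + 1) (ℤ.pos-* a b)) ⟩
    ℚᵘ.mkℚᵘ (+ a) 0 ℚᵘ.* ℚᵘ.mkℚᵘ (+ b) 0        ≈⟨ ℚᵘ.*-cong (toℚᵘ-ℕtoℚ a) (toℚᵘ-ℕtoℚ b) ⟨
    toℚᵘ (ℕtoℚ a) ℚᵘ.* toℚᵘ (ℕtoℚ b)           ≈⟨ toℚᵘ-homo-* (ℕtoℚ a) (ℕtoℚ b) ⟨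
    toℚᵘ (ℕtoℚ a * ℕtoℚ b)                     ∎)
    where open ℚᵘ.≃-Reasoning

  ℕtoℚ-^ : ∀ a k → ℕtoℚ (a ℕ.^ k) ≡ ℕtoℚ a ^ℚ k
  ℕtoℚ-^ a zero    = refl
  ℕtoℚ-^ a (suc k) = trans (ℕtoℚ-* a (a ℕ.^ k)) (cong (ℕtoℚ a *_) (ℕtoℚ-^ a k))

  ℕtoℚ-nonNeg : ∀ n → 0ℚ ≤ ℕtoℚ n
  ℕtoℚ-nonNeg n = nonNegative⁻¹ (ℕtoℚ n) {{normalize-nonNeg n 1}}

  ℕtoℚ-mono-≤ : ∀ {a b} → a ℕ.≤ b → ℕtoℚ a ≤ ℕtoℚ b
  ℕtoℚ-mono-≤ {a} a≤b with ℕ.m≤n⇒∃[o]m+o≡n a≤b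
  ... | c , refl = begin
    ℕtoℚ a               ≡⟨ +-identityʳ (ℕtoℚ a) ⟨
    ℕtoℚ a + 0ℚ          ≤⟨ +-monoʳ-≤ (ℕtoℚ a) (ℕtoℚ-nonNeg c) ⟩
    ℕtoℚ a + ℕtoℚ c      ≡⟨ ℕtoℚ-+ a c ⟨
    ℕtoℚ (a ℕ.+ c)       ∎
    where open ≤-Reasoning

  1/[1+_] : ℕ → ℚ
  1/[1+ k ] = mkℚ (+ 1) k (1-coprimeTo (suc k))

  1/[1+k]-pos : ∀ k → 0ℚ < 1/[1+ k ]
  1/[1+k]-pos k = positive⁻¹ 1/[1+ k ]

  1/[1+k]*[1+k]≡1 : ∀ k → 1/[1+ k ] * ℕtoℚ (suc k) ≡ 1ℚ
  1/[1+k]*[1+k]≡1 k = toℚᵘ-injective (begin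
    toℚᵘ (1/[1+ k ] * ℕtoℚ (suc k))                 ≈⟨ toℚᵘ-homo-* 1/[1+ k ] (ℕtoℚ (suc k)) ⟩
    ℚᵘ.mkℚᵘ (+ 1) k ℚᵘ.* toℚᵘ (ℕtoℚ (suc k))         ≈⟨ ℚᵘ.*-congˡ {ℚᵘ.mkℚᵘ (+ 1) k} (toℚᵘ-ℕtoℚ (suc k)) ⟩
    ℚᵘ.mkℚᵘ (+ 1) k ℚᵘ.* ℚᵘ.mkℚᵘ (+ suc k) 0         ≈⟨ ℚᵘ.*≡* (ℤ-solve 1 (λ x → (con (+ 1) :* x) :* con (+ 1) := con (+ 1) :* (x :* con (+ 1))) refl (+ suc k)) ⟩
    ℚᵘ.1ℚᵘ                                           ∎)
    where
    open ℚᵘ.≃-Reasoning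
    open ℤ-Solver using (con; _:*_; _:=_) renaming (solve to ℤ-solve)

  1/denominator≤ : ∀ q → 0ℚ < q → 1/[1+ ℚ.denominator-1 q ] ≤ q
  1/denominator≤ (mkℚ +[1+ a ] d _) _ = *≤* (ℤ.+≤+ (ℕ.*-monoˡ-≤ (suc d) (ℕ.s≤s (ℕ.z≤n {a}))))
  1/denominator≤ (mkℚ (+ zero) d _) (*<* (ℤ.+<+ ()))
  1/denominator≤ (mkℚ -[1+ a ] d _) (*<* ())

  p≤q⇒0≤q-p : ∀ {p q} → p ≤ q → 0ℚ ≤ q - p
  p≤q⇒0≤q-p {p} {q} p≤q = subst (_≤ q - p) (+-inverseʳ p) (+-monoˡ-≤ (- p) p≤q)

  0≤½ : 0ℚ ≤ ½
  0≤½ = *≤* (ℤ.+≤+ ℕ.z≤n)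

  ½≤1 : ½ ≤ 1ℚ
  ½≤1 = *≤* (ℤ.+≤+ (ℕ.s≤s ℕ.z≤n))

  *-nonNeg : ∀ {a b} → 0ℚ ≤ a → 0ℚ ≤ b → 0ℚ ≤ a * b
  *-nonNeg {a} {b} 0≤a 0≤b = nonNegative⁻¹ (a * b)
    {{nonNeg*nonNeg⇒nonNeg a {{nonNegative 0≤a}} b {{nonNegative 0≤b}}}}

  *-mono-≤-nonNeg : ∀ {a b c d} → 0ℚ ≤ a → a ≤ b → 0ℚ ≤ c → c ≤ d → a * c ≤ b * d
  *-mono-≤-nonNeg {a} {b} {c} {d} 0≤a a≤b 0≤c c≤d = begin
    a * c  ≤⟨ *-monoʳ-≤-nonNeg c {{nonNegative 0≤c}} a≤b ⟩
    b * c  ≤⟨ *-monoˡ-≤-nonNeg b {{nonNegative (≤-trans 0≤a a≤b)}} c≤d ⟩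
    b * d  ∎
    where open ≤-Reasoning

  private
    ^ℚ≡^ : ∀ q k → q ^ℚ k ≡ q E.^ k
    ^ℚ≡^ q zero    = refl
    ^ℚ≡^ q (suc k) = cong (q *_) (^ℚ≡^ q k)

  ^ℚ-+ : ∀ q j k → q ^ℚ (j ℕ.+ k) ≡ q ^ℚ j * q ^ℚ k
  ^ℚ-+ q j k rewrite ^ℚ≡^ q (j ℕ.+ k) | ^ℚ≡^ q j | ^ℚ≡^ q k = E.^-homo-* q j k

  ^ℚ-* : ∀ q j k → q ^ℚ (j ℕ.* k) ≡ (q ^ℚ j) ^ℚ k
  ^ℚ-* q j k rewrite ^ℚ≡^ (q ^ℚ j) k | ^ℚ≡^ q j | ^ℚ≡^ q (j ℕ.* k) = sym (E.^-assocʳ q j k)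

  ^ℚ-distrib-* : ∀ a b k → (a * b) ^ℚ k ≡ a ^ℚ k * b ^ℚ k
  ^ℚ-distrib-* a b k rewrite ^ℚ≡^ (a * b) k | ^ℚ≡^ a k | ^ℚ≡^ b k = E.^-distrib-* a b k

  1^ℚ : ∀ k → 1ℚ ^ℚ k ≡ 1ℚ
  1^ℚ zero    = refl
  1^ℚ (suc k) = cong (1ℚ *_) (1^ℚ k)

  2^k*½^k≡1 : ∀ k → ℕtoℚ 2 ^ℚ k * ½ ^ℚ k ≡ 1ℚ
  2^k*½^k≡1 k = trans (sym (^ℚ-distrib-* (ℕtoℚ 2) ½ k)) (1^ℚ k)

  ^ℚ-nonNeg : ∀ {q} k → 0ℚ ≤ q → 0ℚ ≤ q ^ℚ k
  ^ℚ-nonNeg zero    0≤q = *≤* (ℤ.+≤+ ℕ.z≤n)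
  ^ℚ-nonNeg (suc k) 0≤q = *-nonNeg 0≤q (^ℚ-nonNeg k 0≤q)

  ^ℚ-mono-≤ : ∀ {a b} k → 0ℚ ≤ a → a ≤ b → a ^ℚ k ≤ b ^ℚ k
  ^ℚ-mono-≤ zero    0≤a a≤b = ≤-refl
  ^ℚ-mono-≤ (suc k) 0≤a a≤b = *-mono-≤-nonNeg 0≤a a≤b (^ℚ-nonNeg k 0≤a) (^ℚ-mono-≤ k 0≤a a≤b)

  ^ℚ-≤1 : ∀ {q} k → 0ℚ ≤ q → q ≤ 1ℚ → q ^ℚ k ≤ 1ℚ
  ^ℚ-≤1 {q} k 0≤q q≤1 = subst (q ^ℚ k ≤_) (1^ℚ k) (^ℚ-mono-≤ k 0≤q q≤1)

  1≤^ℚ : ∀ {q} k → 1ℚ ≤ q → 1ℚ ≤ q ^ℚ k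
  1≤^ℚ {q} k 1≤q = subst (_≤ q ^ℚ k) (1^ℚ k) (^ℚ-mono-≤ k (*≤* (ℤ.+≤+ ℕ.z≤n)) 1≤q)

  ^ℚ-antitone : ∀ {q j k} → j ℕ.≤ k → 0ℚ ≤ q → q ≤ 1ℚ → q ^ℚ k ≤ q ^ℚ j
  ^ℚ-antitone {q} {j} j≤k 0≤q q≤1 with ℕ.m≤n⇒∃[o]m+o≡n j≤k
  ... | i , refl = begin
    q ^ℚ (j ℕ.+ i)     ≡⟨ ^ℚ-+ q j i ⟩
    q ^ℚ j * q ^ℚ i    ≤⟨ *-monoˡ-≤-nonNeg (q ^ℚ j) {{nonNegative (^ℚ-nonNeg j 0≤q)}} (^ℚ-≤1 i 0≤q q≤1) ⟩
    q ^ℚ j * 1ℚ        ≡⟨ *-identityʳ (q ^ℚ j) ⟩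
    q ^ℚ j             ∎
    where open ≤-Reasoning

  0≤1-q^k*½ : ∀ {q} k → 0ℚ ≤ q → q ≤ 1ℚ → 0ℚ ≤ 1ℚ - q ^ℚ k * ½
  0≤1-q^k*½ k 0≤q q≤1 =
    p≤q⇒0≤q-p (≤-trans (*-mono-≤-nonNeg (^ℚ-nonNeg k 0≤q) (^ℚ-≤1 k 0≤q q≤1) 0≤½ ½≤1) (≤-reflexive (*-identityˡ 1ℚ)))

  bernoulli : ∀ k y → 0ℚ ≤ y → y ≤ 1ℚ → (1ℚ - y) ^ℚ k * (1ℚ + ℕtoℚ k * y) ≤ 1ℚ
  bernoulli zero    y _   _   = ≤-reflexive (solve 1 (λ y → con 1ℚ :* (con 1ℚ :+ con 0ℚ :* y) := con 1ℚ) refl y)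
    where open +-*-Solver
  bernoulli (suc k) y 0≤y y≤1 = begin
    (1ℚ - y) ^ℚ suc k * (1ℚ + ℕtoℚ (suc k) * y)  ≡⟨ expand ⟩
    A * (1ℚ + ℕtoℚ k * y) - A * (1ℚ + ℕtoℚ k) * y * y
                                                  ≤⟨ +-monoʳ-≤ (A * (1ℚ + ℕtoℚ k * y)) (neg-antimono-≤ loss-nonNeg) ⟩
    A * (1ℚ + ℕtoℚ k * y) - 0ℚ                    ≡⟨ +-identityʳ _ ⟩
    A * (1ℚ + ℕtoℚ k * y)                         ≤⟨ bernoulli k y 0≤y y≤1 ⟩
    1ℚ                                            ∎
    where
    open ≤-Reasoning
    open +-*-Solver
    A = (1ℚ - y) ^ℚ k
    expand : (1ℚ - y) ^ℚ suc k * (1ℚ + ℕtoℚ (suc k) * y) ≡ A * (1ℚ + ℕtoℚ k * y) - A * (1ℚ + ℕtoℚ k) * y * y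
    expand rewrite ℕtoℚ-+ 1 k =
      solve 3 (λ y A k → ((con 1ℚ :- y) :* A) :* (con 1ℚ :+ (con 1ℚ :+ k) :* y)
                         := A :* (con 1ℚ :+ k :* y) :- A :* (con 1ℚ :+ k) :* y :* y) refl y A (ℕtoℚ k)
    loss-nonNeg : 0ℚ ≤ A * (1ℚ + ℕtoℚ k) * y * y
    loss-nonNeg = *-nonNeg (*-nonNeg (*-nonNeg (^ℚ-nonNeg k (p≤q⇒0≤q-p y≤1)) (subst (0ℚ ≤_) (ℕtoℚ-+ 1 k) (ℕtoℚ-nonNeg (suc k)))) 0≤y) 0≤y

  1≤2^s*½^k : ∀ {k s} → k ℕ.< s → 1ℚ ≤ ℕtoℚ 2 ^ℚ s * ½ ^ℚ k
  1≤2^s*½^k {k} (ℕ.s≤s k≤s′) with ℕ.m≤n⇒∃[o]m+o≡n k≤s′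
  ... | i , refl = begin
    1ℚ                                      ≤⟨ 1≤^ℚ {ℕtoℚ 2} (suc i) (*≤* (ℤ.+≤+ (ℕ.s≤s ℕ.z≤n))) ⟩
    ℕtoℚ 2 ^ℚ suc i                         ≡⟨ *-identityʳ _ ⟨
    ℕtoℚ 2 ^ℚ suc i * 1ℚ                    ≡⟨ cong (ℕtoℚ 2 ^ℚ suc i *_) (2^k*½^k≡1 k) ⟨
    ℕtoℚ 2 ^ℚ suc i * (ℕtoℚ 2 ^ℚ k * ½ ^ℚ k) ≡⟨ *-assoc (ℕtoℚ 2 ^ℚ suc i) _ _ ⟨
    ℕtoℚ 2 ^ℚ suc i * ℕtoℚ 2 ^ℚ k * ½ ^ℚ k  ≡⟨ cong (_* ½ ^ℚ k) (^ℚ-+ (ℕtoℚ 2) (suc i) k) ⟨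
    ℕtoℚ 2 ^ℚ (suc i ℕ.+ k) * ½ ^ℚ k        ≡⟨ cong (λ j → ℕtoℚ 2 ^ℚ j * ½ ^ℚ k) (trans (ℕ.+-comm (suc i) k) (ℕ.+-suc k i)) ⟩
    ℕtoℚ 2 ^ℚ suc (k ℕ.+ i) * ½ ^ℚ k        ∎
    where open ≤-Reasoning

module Exponential where

  open import Data.Nat
  open import Data.Nat.Properties
  open import Data.Nat.DivMod
  open import Data.Nat.Tactic.RingSolver using (solve-∀)
  open import Relation.Binary.PropositionalEquality

  n<2^n : ∀ a → a < 2 ^ a
  n<2^n zero    = s≤s z≤n
  n<2^n (suc a) = subst (suc (suc a) ≤_) (cong (2 ^ a +_) (sym (+-identityʳ (2 ^ a))))
                        (+-mono-≤ (m^n>0 2 a) (n<2^n a))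

  cubic≤exp : ∀ C t → 625 * C ≤ t → C * suc t ^ 3 ≤ 2 ^ t
  cubic≤exp C t 625C≤t = begin
    C * suc t ^ 3             ≤⟨ *-monoʳ-≤ C (^-monoˡ-≤ 3 suc-t≤5*2^a) ⟩
    C * (5 * 2 ^ a) ^ 3       ≡⟨ expand C (2 ^ a) ⟩
    (125 * C) * (2 ^ a) ^ 3   ≤⟨ *-monoˡ-≤ ((2 ^ a) ^ 3) (≤-trans 125C≤a (<⇒≤ (n<2^n a))) ⟩
    (2 ^ a) ^ 4               ≡⟨ ^-*-assoc 2 a 4 ⟩
    2 ^ (a * 4)               ≤⟨ ^-monoʳ-≤ 2 (≤-trans (*-monoʳ-≤ a (n≤1+n 4)) (m/n*n≤m t 5)) ⟩
    2 ^ t                     ∎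
    where
    open ≤-Reasoning
    a = t / 5
    expand : ∀ c x → c * (5 * x * (5 * x * (5 * x * 1))) ≡ (125 * c) * (x * (x * (x * 1)))
    expand = solve-∀
    suc-t≤5*2^a : suc t ≤ 5 * 2 ^ a
    suc-t≤5*2^a = begin
      suc t              ≡⟨ cong suc (m≡m%n+[m/n]*n t 5) ⟩
      suc (t % 5) + a * 5 ≤⟨ +-monoˡ-≤ (a * 5) (m%n<n t 5) ⟩
      suc a * 5          ≤⟨ *-monoˡ-≤ 5 (n<2^n a) ⟩
      2 ^ a * 5          ≡⟨ *-comm (2 ^ a) 5 ⟩
      5 * 2 ^ a          ∎
    regroup : ∀ c → 625 * c ≡ 125 * c * 5
    regroup = solve-∀
    125C≤a : 125 * C ≤ a
    125C≤a = subst (_≤ a) (m*n/n≡m (125 * C) 5)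
                   (/-monoˡ-≤ 5 (subst (_≤ t) (regroup C) 625C≤t))

module SubsetCounting where

  open import Data.Nat as ℕ using (ℕ; zero; suc; _≤_; _<_)
  import Data.Nat.Properties as ℕ
  open import Data.Fin using (Fin; zero; suc)
  open import Data.Fin.Properties using (injective⇒≤; ¬∀⟶∃¬; any?; suc-injective; _≟_)
  open import Data.Fin.Subset
  open import Data.Fin.Subset.Properties
  open import Data.Vec using (_∷_; here; there)
  open import Data.Bool using (true; false)
  open import Data.List as List using (List; length; lookup) renaming (_∷_ to _∷ₗ_; [] to []ₗ)
  import Data.List.Properties as List
  open import Data.List.Membership.Propositional using () renaming (_∈_ to _∈ₗ_)
  open import Data.List.Membership.Propositional.Properties using (∈-tabulate⁺)
  import Data.List.Membership.DecPropositional as DecMembership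
  open import Data.List.Relation.Unary.Any using (index) renaming (here to hereₗ; there to thereₗ)
  open import Data.List.Relation.Unary.Any.Properties using (lookup-index)
  open import Data.List.Relation.Unary.All using (All)
  open import Data.List.Relation.Unary.All.Properties using (¬Any⇒All¬)
  open import Data.Product using (∃; _×_; _,_; map₂)
  open import Data.Empty using (⊥-elim)
  open import Data.Sum using (_⊎_; inj₁; inj₂)
  open import Relation.Nullary using (¬_; yes; no)
  open import Relation.Nullary.Decidable using (_×-dec_; ¬?)
  open import Relation.Binary.PropositionalEquality

  private
    variable
      n : ℕ

  enumerate : (p : Subset n) → Fin ∣ p ∣ → Fin n
  enumerate (true  ∷ p) zero    = zero
  enumerate (true  ∷ p) (suc j) = suc (enumerate p j)
  enumerate (false ∷ p) j       = suc (enumerate p j)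

  enumerate-∈ : ∀ (p : Subset n) j → enumerate p j ∈ p
  enumerate-∈ (true  ∷ p) zero    = here
  enumerate-∈ (true  ∷ p) (suc j) = there (enumerate-∈ p j)
  enumerate-∈ (false ∷ p) j       = there (enumerate-∈ p j)

  enumerate-injective : ∀ (p : Subset n) {i j} → enumerate p i ≡ enumerate p j → i ≡ j
  enumerate-injective (true  ∷ p) {zero}  {zero}  _  = refl
  enumerate-injective (true  ∷ p) {zero}  {suc _} ()
  enumerate-injective (true  ∷ p) {suc _} {zero}  ()
  enumerate-injective (true  ∷ p) {suc i} {suc j} eq = cong suc (enumerate-injective p (suc-injective eq))
  enumerate-injective (false ∷ p)                 eq = enumerate-injective p (suc-injective eq)

  enumerate-surjective : ∀ (p : Subset n) {x} → x ∈ p → ∃ λ j → enumerate p j ≡ x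
  enumerate-surjective (true  ∷ p) here        = zero , refl
  enumerate-surjective (true  ∷ p) (there x∈p) with enumerate-surjective p x∈p
  ... | j , refl = suc j , refl
  enumerate-surjective (false ∷ p) (there x∈p) with enumerate-surjective p x∈p
  ... | j , refl = j , refl

  elements : Subset n → List (Fin n)
  elements p = List.tabulate (enumerate p)

  length-elements : ∀ (p : Subset n) → length (elements p) ≡ ∣ p ∣
  length-elements p = List.length-tabulate (enumerate p)

  ∈-elements : ∀ {p : Subset n} {x} → x ∈ p → x ∈ₗ elements p
  ∈-elements {p = p} x∈p with enumerate-surjective p x∈p
  ... | j , refl = ∈-tabulate⁺ j

  ∣p∣≤length : ∀ (p : Subset n) (L : List (Fin n)) → (∀ {x} → x ∈ p → x ∈ₗ L) → ∣ p ∣ ≤ length L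
  ∣p∣≤length p L p⊆L = injective⇒≤ {f = position} position-injective
    where
    position : Fin ∣ p ∣ → Fin (length L)
    position j = index (p⊆L (enumerate-∈ p j))
    position-injective : ∀ {i j} → position i ≡ position j → i ≡ j
    position-injective {i} {j} eq = enumerate-injective p (begin
      enumerate p i             ≡⟨ lookup-index (p⊆L (enumerate-∈ p i)) ⟩
      lookup L (position i)     ≡⟨ cong (lookup L) eq ⟩
      lookup L (position j)     ≡⟨ lookup-index (p⊆L (enumerate-∈ p j)) ⟨
      enumerate p j             ∎)
      where open ≡-Reasoning

  -- opaque: unfolding this search makes checking the path constructions below infeasible
  opaque
    ∃-avoiding : ∀ (L : List (Fin n)) → length L < n → ∃ λ x → All (x ≢_) L
    ∃-avoiding {n} L short = map₂ (¬Any⇒All¬ L) (¬∀⟶∃¬ n (_∈ₗ L) (_∈ₗ? L) not-all)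
      where
      open DecMembership (_≟_ {n}) using () renaming (_∈?_ to _∈ₗ?_)
      not-all : ¬ (∀ x → x ∈ₗ L)
      not-all all∈L = ℕ.<⇒≱ short (subst (_≤ length L) (∣⊤∣≡n n) (∣p∣≤length ⊤ L (λ {x} _ → all∈L x)))

  2<∣p∣⇒∃third : ∀ {p : Subset n} → 2 < ∣ p ∣ → ∀ x y → ∃ λ z → z ∈ p × z ≢ x × z ≢ y
  2<∣p∣⇒∃third {p = p} 2<∣p∣ x y with any? (λ z → z ∈? p ×-dec ¬? (z ≟ x) ×-dec ¬? (z ≟ y))
  ... | yes third = third
  ... | no ∄third = ⊥-elim (ℕ.<⇒≱ 2<∣p∣ (∣p∣≤length p (x ∷ₗ y ∷ₗ []ₗ) p⊆xy))
    where
    p⊆xy : ∀ {z} → z ∈ p → z ∈ₗ (x ∷ₗ y ∷ₗ []ₗ)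
    p⊆xy {z} z∈p with z ≟ x | z ≟ y
    ... | yes z≡x | _       = hereₗ z≡x
    ... | no _    | yes z≡y = thereₗ (hereₗ z≡y)
    ... | no z≢x  | no z≢y  = ⊥-elim (∄third (z , z∈p , z≢x , z≢y))

  ∈-triple⁻ : ∀ {a b c w : Fin n} → w ∈ triple a b c → w ≡ a ⊎ w ≡ b ⊎ w ≡ c
  ∈-triple⁻ {a = a} {b} {c} w∈t with x∈p∪q⁻ ⁅ a ⁆ (⁅ b ⁆ ∪ ⁅ c ⁆) w∈t
  ... | inj₁ w∈a = inj₁ (x∈⁅y⁆⇒x≡y a w∈a)
  ... | inj₂ w∈bc with x∈p∪q⁻ ⁅ b ⁆ ⁅ c ⁆ w∈bc
  ...   | inj₁ w∈b = inj₂ (inj₁ (x∈⁅y⁆⇒x≡y b w∈b))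
  ...   | inj₂ w∈c = inj₂ (inj₂ (x∈⁅y⁆⇒x≡y c w∈c))

  ∈-triple⁺ : ∀ {a b c w : Fin n} → w ≡ a ⊎ w ≡ b ⊎ w ≡ c → w ∈ triple a b c
  ∈-triple⁺ {a = a} {b} {c} (inj₁ refl)        = x∈p∪q⁺ (inj₁ (x∈⁅x⁆ a))
  ∈-triple⁺ {a = a} {b} {c} (inj₂ (inj₁ refl)) = x∈p∪q⁺ (inj₂ (x∈p∪q⁺ (inj₁ (x∈⁅x⁆ b))))
  ∈-triple⁺ {a = a} {b} {c} (inj₂ (inj₂ refl)) = x∈p∪q⁺ (inj₂ (x∈p∪q⁺ (inj₂ (x∈⁅x⁆ c))))

  triple-⊆ : ∀ {a b c} {p : Subset n} → a ∈ p → b ∈ p → c ∈ p → triple a b c ⊆ p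
  triple-⊆ a∈p b∈p c∈p w∈t with ∈-triple⁻ w∈t
  ... | inj₁ refl        = a∈p
  ... | inj₂ (inj₁ refl) = b∈p
  ... | inj₂ (inj₂ refl) = c∈p

  ⊂-⁅⁆∪ : ∀ {x} {p : Subset n} → x ∉ p → p ⊂ ⁅ x ⁆ ∪ p
  ⊂-⁅⁆∪ {x = x} {p} x∉p = q⊆p∪q ⁅ x ⁆ p , x , p⊆p∪q p (x∈⁅x⁆ x) , x∉p

  3≤∣triple∣ : ∀ {a b c : Fin n} → a ≢ b → a ≢ c → b ≢ c → 3 ≤ ∣ triple a b c ∣
  3≤∣triple∣ {a = a} {b} {c} a≢b a≢c b≢c = begin
    3                        ≡⟨ cong (2 ℕ.+_) (∣⁅x⁆∣≡1 c) ⟨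
    2 ℕ.+ ∣ ⁅ c ⁆ ∣          ≤⟨ ℕ.+-monoʳ-≤ 1 (p⊂q⇒∣p∣<∣q∣ (⊂-⁅⁆∪ b∉c)) ⟩
    suc ∣ ⁅ b ⁆ ∪ ⁅ c ⁆ ∣    ≤⟨ p⊂q⇒∣p∣<∣q∣ (⊂-⁅⁆∪ a∉bc) ⟩
    ∣ triple a b c ∣          ∎
    where
    open ℕ.≤-Reasoning
    b∉c : b ∉ ⁅ c ⁆
    b∉c = x≢y⇒x∉⁅y⁆ b≢c
    a∉bc : a ∉ ⁅ b ⁆ ∪ ⁅ c ⁆
    a∉bc a∈bc with x∈p∪q⁻ ⁅ b ⁆ ⁅ c ⁆ a∈bc
    ... | inj₁ a∈b = a≢b (x∈⁅y⁆⇒x≡y b a∈b)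
    ... | inj₂ a∈c = a≢c (x∈⁅y⁆⇒x≡y c a∈c)

  ∣p∣≡3⇒p≡triple : ∀ {p : Subset n} {a b c} → ∣ p ∣ ≡ 3 → a ∈ p → b ∈ p → c ∈ p →
                   a ≢ b → a ≢ c → b ≢ c → p ≡ triple a b c
  ∣p∣≡3⇒p≡triple {p = p} {a} {b} {c} ∣p∣≡3 a∈p b∈p c∈p a≢b a≢c b≢c =
    ⊆-antisym p⊆t (triple-⊆ a∈p b∈p c∈p)
    where
    p⊆t : p ⊆ triple a b c
    p⊆t {w} w∈p with w ∈? triple a b c
    ... | yes w∈t = w∈t
    ... | no  w∉t = ⊥-elim (ℕ.<⇒≱ (p⊂q⇒∣p∣<∣q∣ (triple-⊆ a∈p b∈p c∈p , w , w∈p , w∉t))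
                                  (subst (_≤ ∣ triple a b c ∣) (sym ∣p∣≡3) (3≤∣triple∣ a≢b a≢c b≢c)))

module SteinerQuasigroup {n} (G : Hypergraph3 n) (sts : IsSTS G) where

  open SubsetCounting
  open import Data.Nat.Properties using (≤-reflexive)
  open import Data.Fin using (Fin)
  open import Data.Fin.Properties using (_≟_)
  open import Data.Fin.Subset using (_∈_)
  open import Data.Product using (∃; _×_; _,_; proj₁; proj₂)
  open import Data.Sum using (inj₁; inj₂)
  open import Data.Empty using (⊥-elim)
  open import Relation.Nullary using (Dec; yes; no)
  open import Relation.Binary.PropositionalEquality

  private
    line : ∀ {x y} → x ≢ y → ∃ λ z → z ≢ x × z ≢ y × Edge G (triple x z y)
    line {x} {y} x≢y with sts x y x≢y
    ... | e , (e∈G , x∈e , y∈e) , _ with 2<∣p∣⇒∃third (≤-reflexive (sym (uniform3 G e e∈G))) x y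
    ... | z , z∈e , z≢x , z≢y =
      z , z≢x , z≢y , subst (Edge G) (∣p∣≡3⇒p≡triple (uniform3 G e e∈G) x∈e z∈e y∈e (≢-sym z≢x) x≢y z≢y) e∈G

    third : ∀ x y → Dec (x ≡ y) → Fin n
    third x y (yes _)  = x
    third x y (no x≢y) = proj₁ (line x≢y)

  -- The Steiner quasigroup of G; x · x = x only makes _·_ total.
  infixl 7 _·_
  _·_ : Fin n → Fin n → Fin n
  x · y = third x y (x ≟ y)

  private
    ·-line : ∀ {x y} → x ≢ y → x · y ≢ x × x · y ≢ y × Edge G (triple x (x · y) y)
    ·-line {x} {y} x≢y with x ≟ y
    ... | yes x≡y  = ⊥-elim (x≢y x≡y)
    ... | no  x≢y′ = proj₂ (line x≢y′)

  ·-≢ˡ : ∀ {x y} → x ≢ y → x · y ≢ x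
  ·-≢ˡ x≢y = proj₁ (·-line x≢y)

  ·-≢ʳ : ∀ {x y} → x ≢ y → x · y ≢ y
  ·-≢ʳ x≢y = proj₁ (proj₂ (·-line x≢y))

  ·-edge : ∀ {x y} → x ≢ y → Edge G (triple x (x · y) y)
  ·-edge x≢y = proj₂ (proj₂ (·-line x≢y))

  ·-unique : ∀ {e x y w} → Edge G e → x ∈ e → y ∈ e → w ∈ e → x ≢ y → w ≢ x → w ≢ y → x · y ≡ w
  ·-unique {e} {x} {y} {w} e∈G x∈e y∈e w∈e x≢y w≢x w≢y with sts x y x≢y
  ... | _ , _ , unique with ∈-triple⁻ (subst (w ∈_) e≡line w∈e)
    where
    e≡line : e ≡ triple x (x · y) y
    e≡line = trans (unique e e∈G x∈e y∈e)
                   (sym (unique _ (·-edge x≢y) (∈-triple⁺ (inj₁ refl)) (∈-triple⁺ (inj₂ (inj₂ refl)))))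
  ... | inj₁ w≡x          = ⊥-elim (w≢x w≡x)
  ... | inj₂ (inj₁ w≡x·y) = sym w≡x·y
  ... | inj₂ (inj₂ w≡y)   = ⊥-elim (w≢y w≡y)

  ·-comm : ∀ {x y} → x ≢ y → x · y ≡ y · x
  ·-comm x≢y = sym (·-unique (·-edge x≢y) (∈-triple⁺ (inj₂ (inj₂ refl))) (∈-triple⁺ (inj₁ refl))
                             (∈-triple⁺ (inj₂ (inj₁ refl))) (≢-sym x≢y) (·-≢ʳ x≢y) (·-≢ˡ x≢y))

  ·-cancelˡ : ∀ {x y} → x ≢ y → x · (x · y) ≡ y
  ·-cancelˡ x≢y = ·-unique (·-edge x≢y) (∈-triple⁺ (inj₁ refl)) (∈-triple⁺ (inj₂ (inj₁ refl)))
                           (∈-triple⁺ (inj₂ (inj₂ refl))) (≢-sym (·-≢ˡ x≢y)) (≢-sym x≢y) (≢-sym (·-≢ʳ x≢y))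

  ·-cancelʳ : ∀ {x y} → x ≢ y → y · (x · y) ≡ x
  ·-cancelʳ x≢y = ·-unique (·-edge x≢y) (∈-triple⁺ (inj₂ (inj₂ refl))) (∈-triple⁺ (inj₂ (inj₁ refl)))
                           (∈-triple⁺ (inj₁ refl)) (≢-sym (·-≢ʳ x≢y)) x≢y (≢-sym (·-≢ˡ x≢y))

  ·-avoids : ∀ {x y w} → x ≢ w → w ≢ x · y → x · w ≢ y
  ·-avoids x≢w w≢x·y refl = w≢x·y (sym (·-cancelˡ x≢w))

module FiniteSums where

  open RationalArithmetic
  open import Data.Nat as ℕ using (ℕ; zero; suc)
  open import Data.Fin using (Fin; zero; suc)
  open import Data.Fin.Properties using (suc-injective)
  import Data.Integer as ℤ
  open import Data.Fin.Subset using (∣_∣)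
  open import Data.Vec using (tabulate)
  open import Data.Bool using (Bool; true; false; if_then_else_)
  open import Data.Rational hiding (∣_∣)
  open import Data.Rational.Properties
  open import Data.Rational.Solver using (module +-*-Solver)
  open import Function using (_∘_)
  open import Relation.Binary.PropositionalEquality

  private
    variable
      k : ℕ

  ∑ : (Fin k → ℚ) → ℚ
  ∑ {zero}  f = 0ℚ
  ∑ {suc k} f = f zero + ∑ (f ∘ suc)

  ∏ : (Fin k → ℚ) → ℚ
  ∏ {zero}  f = 1ℚ
  ∏ {suc k} f = f zero * ∏ (f ∘ suc)

  ∑-cong : ∀ {f g : Fin k → ℚ} → (∀ i → f i ≡ g i) → ∑ f ≡ ∑ g
  ∑-cong {zero}  f≡g = refl
  ∑-cong {suc k} f≡g = cong₂ _+_ (f≡g zero) (∑-cong (f≡g ∘ suc))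

  ∑-mono-≤ : ∀ {f g : Fin k → ℚ} → (∀ i → f i ≤ g i) → ∑ f ≤ ∑ g
  ∑-mono-≤ {zero}  f≤g = ≤-refl
  ∑-mono-≤ {suc k} f≤g = +-mono-≤ (f≤g zero) (∑-mono-≤ (f≤g ∘ suc))

  ∑-nonNeg : ∀ {f : Fin k → ℚ} → (∀ i → 0ℚ ≤ f i) → 0ℚ ≤ ∑ f
  ∑-nonNeg {zero}  0≤f = ≤-refl
  ∑-nonNeg {suc k} 0≤f = +-mono-≤ (0≤f zero) (∑-nonNeg (0≤f ∘ suc))

  term≤∑ : ∀ {f : Fin k → ℚ} → (∀ i → 0ℚ ≤ f i) → ∀ i → f i ≤ ∑ f
  term≤∑ {suc k} {f} 0≤f zero    = begin
    f zero                 ≡⟨ +-identityʳ (f zero) ⟨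
    f zero + 0ℚ            ≤⟨ +-monoʳ-≤ (f zero) (∑-nonNeg (0≤f ∘ suc)) ⟩
    f zero + ∑ (f ∘ suc)   ∎
    where open ≤-Reasoning
  term≤∑ {suc k} {f} 0≤f (suc i) = begin
    f (suc i)              ≤⟨ term≤∑ (0≤f ∘ suc) i ⟩
    ∑ (f ∘ suc)            ≡⟨ +-identityˡ (∑ (f ∘ suc)) ⟨
    0ℚ + ∑ (f ∘ suc)       ≤⟨ +-monoˡ-≤ (∑ (f ∘ suc)) (0≤f zero) ⟩
    f zero + ∑ (f ∘ suc)   ∎
    where open ≤-Reasoning

  ∑-const : ∀ k x → ∑ {k} (λ _ → x) ≡ ℕtoℚ k * x
  ∑-const zero    x = sym (*-zeroˡ x)
  ∑-const (suc k) x rewrite ∑-const k x | ℕtoℚ-+ 1 k =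
    solve 2 (λ x a → x :+ a :* x := (con 1ℚ :+ a) :* x) refl x (ℕtoℚ k)
    where open +-*-Solver

  ∏-cong : ∀ {f g : Fin k → ℚ} → (∀ i → f i ≡ g i) → ∏ f ≡ ∏ g
  ∏-cong {zero}  f≡g = refl
  ∏-cong {suc k} f≡g = cong₂ _*_ (f≡g zero) (∏-cong (f≡g ∘ suc))

  ∏-nonNeg : ∀ {f : Fin k → ℚ} → (∀ i → 0ℚ ≤ f i) → 0ℚ ≤ ∏ f
  ∏-nonNeg {zero}  0≤f = *≤* (ℤ.+≤+ ℕ.z≤n)
  ∏-nonNeg {suc k} 0≤f = *-nonNeg (0≤f zero) (∏-nonNeg (0≤f ∘ suc))

  ∏-mono-≤ : ∀ {f g : Fin k → ℚ} → (∀ i → 0ℚ ≤ f i) → (∀ i → f i ≤ g i) → ∏ f ≤ ∏ g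
  ∏-mono-≤ {zero}  0≤f f≤g = ≤-refl
  ∏-mono-≤ {suc k} 0≤f f≤g =
    *-mono-≤-nonNeg (0≤f zero) (f≤g zero) (∏-nonNeg (0≤f ∘ suc)) (∏-mono-≤ (0≤f ∘ suc) (f≤g ∘ suc))

  ∏-const : ∀ k x → ∏ {k} (λ _ → x) ≡ x ^ℚ k
  ∏-const zero    x = refl
  ∏-const (suc k) x = cong (x *_) (∏-const k x)

  ∏-if : ∀ (f : Fin k → Bool) x → ∏ (λ i → if f i then x else 1ℚ) ≡ x ^ℚ ∣ tabulate f ∣
  ∏-if {zero}  f x = refl
  ∏-if {suc k} f x with f zero
  ... | true  = cong (x *_) (∏-if (f ∘ suc) x)
  ... | false = trans (*-identityˡ _) (∏-if (f ∘ suc) x)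

  ∏-linear-at : ∀ (j : Fin k) {T F G : Fin k → ℚ} α β →
    (∀ i → i ≢ j → T i ≡ F i) → (∀ i → i ≢ j → G i ≡ F i) → T j ≡ α * F j + β * G j →
    ∏ T ≡ α * ∏ F + β * ∏ G
  ∏-linear-at zero {T} {F} {G} α β T≡F G≡F Tj
    rewrite ∏-cong {f = T ∘ suc} (λ i → T≡F (suc i) λ ()) | ∏-cong {f = G ∘ suc} (λ i → G≡F (suc i) λ ()) | Tj =
    solve 5 (λ a b f g r → (a :* f :+ b :* g) :* r := a :* (f :* r) :+ b :* (g :* r)) refl α β (F zero) (G zero) (∏ (F ∘ suc))
    where open +-*-Solver
  ∏-linear-at (suc j) {T} {F} {G} α β T≡F G≡F Tj
    rewrite ∏-linear-at j {T ∘ suc} {F ∘ suc} {G ∘ suc} α β (λ i i≢j → T≡F (suc i) (i≢j ∘ suc-injective))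
                                                        (λ i i≢j → G≡F (suc i) (i≢j ∘ suc-injective)) Tj
          | T≡F zero (λ ()) | G≡F zero (λ ()) =
    solve 5 (λ a b f x y → f :* (a :* x :+ b :* y) := a :* (f :* x) :+ b :* (f :* y)) refl α β (F zero) (∏ (F ∘ suc)) (∏ (G ∘ suc))
    where open +-*-Solver

module Ownership where

  open import Data.Nat using (ℕ; zero; suc)
  open import Data.Fin using (Fin; zero; suc)
  open import Data.Fin.Properties using (_≟_)
  open import Data.Fin.Subset using (Subset; _∈_; ∣_∣)
  open import Data.Vec using ([]; _∷_; tabulate; here; there)
  open import Data.Bool using (Bool; true; false; _∧_; _∨_; not)
  open import Data.Empty using (⊥-elim)
  open import Relation.Nullary using (yes; no)
  open import Data.Maybe using (Maybe; just; nothing)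
  open import Relation.Nullary.Decidable using (⌊_⌋)
  open import Function using (_∘_)
  open import Relation.Binary.PropositionalEquality

  private
    variable
      k : ℕ

  -- An ownership map Fin m → Maybe (Fin k) gives each coordinate at most one owner i : Fin k;
  -- Kept owner i S says that S contains every coordinate owned by i.
  owns : Maybe (Fin k) → Fin k → Bool
  owns nothing  i = false
  owns (just j) i = ⌊ j ≟ i ⌋

  keptAt : Maybe (Fin k) → Fin k → Bool → Bool
  keptAt nothing  i x = true
  keptAt (just j) i x = x ∨ not ⌊ j ≟ i ⌋

  Kept : ∀ {m} → (Fin m → Maybe (Fin k)) → Fin k → Subset m → Bool
  Kept owner i []      = true
  Kept owner i (x ∷ S) = keptAt (owner zero) i x ∧ Kept (owner ∘ suc) i S

  #Kept : ∀ {m} → (Fin m → Maybe (Fin k)) → Subset m → ℕ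
  #Kept owner S = ∣ tabulate (λ i → Kept owner i S) ∣

  #owned : ∀ {m} → (Fin m → Maybe (Fin k)) → Fin k → ℕ
  #owned owner i = ∣ tabulate (λ b → owns (owner b) i) ∣

  owns⇒≡just : ∀ {o : Maybe (Fin k)} {i} → owns o i ≡ true → o ≡ just i
  owns⇒≡just {o = just j} {i} owns≡true with j ≟ i
  ... | yes refl = refl

  Kept⇒∈ : ∀ {m} (owner : Fin m → Maybe (Fin k)) {i S} b → Kept owner i S ≡ true → owner b ≡ just i → b ∈ S
  Kept⇒∈ owner {i} {x ∷ S} zero kept owner≡i with owner zero
  Kept⇒∈ owner {i} {true  ∷ S} zero kept refl | just .i = here
  Kept⇒∈ owner {i} {false ∷ S} zero kept refl | just .i with i ≟ i
  ... | no i≢i = ⊥-elim (i≢i refl)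
  Kept⇒∈ owner {i} {x ∷ S} (suc b) kept owner≡i =
    there (Kept⇒∈ (owner ∘ suc) b (∧≡true⇒ʳ (keptAt (owner zero) i x) kept) owner≡i)
    where
    ∧≡true⇒ʳ : ∀ x {y} → x ∧ y ≡ true → y ≡ true
    ∧≡true⇒ʳ true y≡true = y≡true

module ProductMeasure (p : ℚ) (0≤p : 0ℚ ℚ.≤ p) (p≤1 : p ℚ.≤ 1ℚ) where

  open RationalArithmetic
  open FiniteSums
  open Ownership
  open import Data.Nat as ℕ using (ℕ; zero; suc; _∸_)
  import Data.Nat.Properties as ℕ
  open import Data.Fin using (Fin; zero; suc)
  open import Data.Fin.Properties using (_≟_)
  open import Data.Fin.Subset using (Subset; ∣_∣)
  open import Data.Fin.Subset.Properties using (∣p∣≤n)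
  open import Data.Vec using ([]; _∷_; tabulate)
  open import Data.Bool using (true; false; if_then_else_; _∧_; not)
  open import Data.Maybe using (Maybe; just; nothing)
  open import Data.List using (List; []; _∷_; _++_; map)
  import Data.List.Properties as List
  open import Data.List.Membership.Propositional using () renaming (_∈_ to _∈ₗ_)
  open import Data.List.Membership.Propositional.Properties using (∈-++⁺ˡ; ∈-++⁺ʳ; ∈-map⁺)
  open import Data.List.Relation.Unary.Any using (here)
  open import Data.Rational hiding (∣_∣; floor; _≟_)
  open import Data.Rational.Properties hiding (_≟_)
  open import Data.Rational.Solver using (module +-*-Solver)
  open import Relation.Nullary using (Dec; yes; no; contradiction)
  open import Relation.Nullary.Decidable using (⌊_⌋)
  open import Relation.Unary using (Decidable)
  open import Function using (_∘_)
  open import Relation.Binary.PropositionalEquality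

  0≤1-p : 0ℚ ≤ 1ℚ - p
  0≤1-p = p≤q⇒0≤q-p p≤1

  Ex : ∀ {m} → (Subset m → ℚ) → ℚ
  Ex {zero}  g = g []
  Ex {suc m} g = p * Ex (λ S → g (true ∷ S)) + (1ℚ - p) * Ex (λ S → g (false ∷ S))

  Ex-cong : ∀ {m} {g h : Subset m → ℚ} → (∀ S → g S ≡ h S) → Ex g ≡ Ex h
  Ex-cong {zero}  g≡h = g≡h []
  Ex-cong {suc m} g≡h = cong₂ (λ x y → p * x + (1ℚ - p) * y) (Ex-cong (g≡h ∘ (true ∷_))) (Ex-cong (g≡h ∘ (false ∷_)))

  Ex-mono-≤ : ∀ {m} {g h : Subset m → ℚ} → (∀ S → g S ≤ h S) → Ex g ≤ Ex h
  Ex-mono-≤ {zero}  g≤h = g≤h []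
  Ex-mono-≤ {suc m} g≤h = +-mono-≤ (*-monoˡ-≤-nonNeg p {{nonNegative 0≤p}} (Ex-mono-≤ (g≤h ∘ (true ∷_))))
                                   (*-monoˡ-≤-nonNeg (1ℚ - p) {{nonNegative 0≤1-p}} (Ex-mono-≤ (g≤h ∘ (false ∷_))))

  Ex-+ : ∀ {m} (g h : Subset m → ℚ) → Ex (λ S → g S + h S) ≡ Ex g + Ex h
  Ex-+ {zero}  g h = refl
  Ex-+ {suc m} g h rewrite Ex-+ (g ∘ (true ∷_)) (h ∘ (true ∷_)) | Ex-+ (g ∘ (false ∷_)) (h ∘ (false ∷_)) =
    solve 6 (λ a b c d e f → a :* (c :+ d) :+ b :* (e :+ f) := (a :* c :+ b :* e) :+ (a :* d :+ b :* f)) refl p (1ℚ - p) _ _ _ _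
    where open +-*-Solver

  Ex-* : ∀ {m} c (g : Subset m → ℚ) → Ex (λ S → c * g S) ≡ c * Ex g
  Ex-* {zero}  c g = refl
  Ex-* {suc m} c g rewrite Ex-* c (g ∘ (true ∷_)) | Ex-* c (g ∘ (false ∷_)) =
    solve 5 (λ a b c d e → a :* (c :* d) :+ b :* (c :* e) := c :* (a :* d :+ b :* e)) refl p (1ℚ - p) c _ _
    where open +-*-Solver

  Ex-0 : ∀ {m} → Ex {m} (λ _ → 0ℚ) ≡ 0ℚ
  Ex-0 {zero}  = refl
  Ex-0 {suc m} rewrite Ex-0 {m} = solve 2 (λ a b → a :* con 0ℚ :+ b :* con 0ℚ := con 0ℚ) refl p (1ℚ - p)
    where open +-*-Solver

  Ex-∑ : ∀ {m k} (g : Fin k → Subset m → ℚ) → Ex (λ S → ∑ (λ i → g i S)) ≡ ∑ (λ i → Ex (g i))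
  Ex-∑ {m} {zero} g = Ex-0 {m}
  Ex-∑ {m} {suc k} g = trans (Ex-+ (g zero) _) (cong (Ex (g zero) +_) (Ex-∑ (g ∘ suc)))

  𝟙 : ∀ {a} {A : Set a} → Dec A → ℚ
  𝟙 (yes _) = 1ℚ
  𝟙 (no _)  = 0ℚ

  outcomes : ∀ {m} {P : Subset m → Set} → Decidable P → List (Subset m)
  outcomes {zero}  P? with P? []
  ... | yes _ = [] ∷ []
  ... | no  _ = []
  outcomes {suc m} P? = map (true ∷_) (outcomes (P? ∘ (true ∷_))) ++ map (false ∷_) (outcomes (P? ∘ (false ∷_)))

  ∈-outcomes : ∀ {m} {P : Subset m → Set} (P? : Decidable P) {S} → P S → S ∈ₗ outcomes P?
  ∈-outcomes {zero}  P? {[]} PS with P? []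
  ... | yes _  = here refl
  ... | no ¬PS = contradiction PS ¬PS
  ∈-outcomes {suc m} P? {true  ∷ S} PS = ∈-++⁺ˡ (∈-map⁺ (true ∷_) (∈-outcomes (P? ∘ (true ∷_)) PS))
  ∈-outcomes {suc m} P? {false ∷ S} PS = ∈-++⁺ʳ _ (∈-map⁺ (false ∷_) (∈-outcomes (P? ∘ (false ∷_)) PS))

  private
    weight-true : ∀ {m} (S : Subset m) → weight p (true ∷ S) ≡ p * weight p S
    weight-true S = *-assoc p _ _

    weight-false : ∀ {m} (S : Subset m) → weight p (false ∷ S) ≡ (1ℚ - p) * weight p S
    weight-false {m} S rewrite ℕ.+-∸-assoc 1 (∣p∣≤n S) =
      solve 3 (λ a b c → a :* (b :* c) := b :* (a :* c)) refl (p ^ℚ ∣ S ∣) (1ℚ - p) ((1ℚ - p) ^ℚ (m ∸ ∣ S ∣))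
      where open +-*-Solver

    sumℚ-++ : ∀ xs ys → sumℚ (xs ++ ys) ≡ sumℚ xs + sumℚ ys
    sumℚ-++ []       ys = sym (+-identityˡ _)
    sumℚ-++ (x ∷ xs) ys = trans (cong (x +_) (sumℚ-++ xs ys)) (sym (+-assoc x _ _))

    total-weight-∷ : ∀ {m} x c → (∀ (S : Subset m) → weight p (x ∷ S) ≡ c * weight p S) →
                     ∀ (L : List (Subset m)) → sumℚ (map (weight p) (map (x ∷_) L)) ≡ c * sumℚ (map (weight p) L)
    total-weight-∷ x c weight-∷ []      = sym (*-zeroʳ c)
    total-weight-∷ x c weight-∷ (S ∷ L) rewrite total-weight-∷ x c weight-∷ L | weight-∷ S =
      sym (*-distribˡ-+ c (weight p S) (sumℚ (map (weight p) L)))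

  total-weight-outcomes : ∀ {m} {P : Subset m → Set} (P? : Decidable P) →
                          sumℚ (map (weight p) (outcomes P?)) ≡ Ex (λ S → 𝟙 (P? S))
  total-weight-outcomes {zero}  P? with P? []
  ... | yes _ = refl
  ... | no  _ = refl
  total-weight-outcomes {suc m} P?
    rewrite List.map-++ (weight p) (map (true ∷_) (outcomes (P? ∘ (true ∷_)))) (map (false ∷_) (outcomes (P? ∘ (false ∷_))))
          | sumℚ-++ (map (weight p) (map (true ∷_) (outcomes (P? ∘ (true ∷_))))) (map (weight p) (map (false ∷_) (outcomes (P? ∘ (false ∷_)))))
          | total-weight-∷ true p weight-true (outcomes (P? ∘ (true ∷_)))
          | total-weight-∷ false (1ℚ - p) weight-false (outcomes (P? ∘ (false ∷_)))
          | total-weight-outcomes (P? ∘ (true ∷_)) | total-weight-outcomes (P? ∘ (false ∷_)) = refl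

  -- Independence: owner j's coordinate only affects the j-th factor, and dropping it turns a j into 1.
  Ex-∏-Kept : ∀ {m k} (owner : Fin m → Maybe (Fin k)) (a : Fin k → ℚ) →
              Ex (λ S → ∏ (λ i → if Kept owner i S then a i else 1ℚ))
                ≡ ∏ (λ i → 1ℚ - p ^ℚ #owned owner i * (1ℚ - a i))
  Ex-∏-Kept {zero} owner a = ∏-cong (λ i → solve 1 (λ x → x := con 1ℚ :- con 1ℚ :* (con 1ℚ :- x)) refl (a i))
    where open +-*-Solver
  Ex-∏-Kept {suc m} owner a with owner zero in owner₀
  ... | nothing rewrite Ex-∏-Kept (owner ∘ suc) a =
    solve 2 (λ p x → p :* x :+ (con 1ℚ :- p) :* x := x) refl p (∏ (λ i → 1ℚ - p ^ℚ #owned (owner ∘ suc) i * (1ℚ - a i)))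
    where open +-*-Solver
  ... | just j = begin
    p * Ex (λ S → ∏ (λ i → if Kept (owner ∘ suc) i S then a i else 1ℚ))
      + (1ℚ - p) * Ex (λ S → ∏ (λ i → if not ⌊ j ≟ i ⌋ ∧ Kept (owner ∘ suc) i S then a i else 1ℚ))
        ≡⟨ cong₂ (λ x y → p * x + (1ℚ - p) * y) (Ex-∏-Kept (owner ∘ suc) a)
                 (trans (Ex-cong (λ S → ∏-cong (unkept S))) (Ex-∏-Kept (owner ∘ suc) a′)) ⟩
    p * ∏ F + (1ℚ - p) * ∏ F′
        ≡⟨ ∏-linear-at j {T} {F} {F′} p (1ℚ - p) T≡F F′≡F Tj ⟨
    ∏ T ∎
    where
    open ≡-Reasoning
    a′ : Fin _ → ℚ
    a′ i = if ⌊ j ≟ i ⌋ then 1ℚ else a i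
    r : Fin _ → ℕ
    r = #owned (owner ∘ suc)
    T F F′ : Fin _ → ℚ
    T i  = 1ℚ - p ^ℚ ∣ owns (just j) i ∷ tabulate (λ b → owns (owner (suc b)) i) ∣ * (1ℚ - a i)
    F i  = 1ℚ - p ^ℚ r i * (1ℚ - a i)
    F′ i = 1ℚ - p ^ℚ r i * (1ℚ - a′ i)
    unkept : ∀ S i → (if not ⌊ j ≟ i ⌋ ∧ Kept (owner ∘ suc) i S then a i else 1ℚ)
                     ≡ (if Kept (owner ∘ suc) i S then a′ i else 1ℚ)
    unkept S i with j ≟ i
    ... | no  _ = refl
    ... | yes _ with Kept (owner ∘ suc) i S
    ...   | true  = refl
    ...   | false = refl
    T≡F : ∀ i → i ≢ j → T i ≡ F i
    T≡F i i≢j with j ≟ i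
    ... | yes j≡i = contradiction (sym j≡i) i≢j
    ... | no  _   = refl
    F′≡F : ∀ i → i ≢ j → F′ i ≡ F i
    F′≡F i i≢j with j ≟ i
    ... | yes j≡i = contradiction (sym j≡i) i≢j
    ... | no  _   = refl
    Tj : T j ≡ p * F j + (1ℚ - p) * F′ j
    Tj with j ≟ j
    ... | no j≢j = contradiction refl j≢j
    ... | yes _  = solve 3 (λ p x a → con 1ℚ :- (p :* x) :* (con 1ℚ :- a)
                                    := p :* (con 1ℚ :- x :* (con 1ℚ :- a)) :+ (con 1ℚ :- p) :* (con 1ℚ :- x :* (con 1ℚ :- con 1ℚ)))
                           refl p (p ^ℚ r j) (a j)
      where open +-*-Solver

  Ex-½^#Kept≤ : ∀ {m k} (owner : Fin m → Maybe (Fin k)) R → (∀ i → #owned owner i ℕ.≤ R) →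
                Ex (λ S → ½ ^ℚ #Kept owner S) ≤ (1ℚ - p ^ℚ R * ½) ^ℚ k
  Ex-½^#Kept≤ {k = k} owner R #owned≤R = begin
    Ex (λ S → ½ ^ℚ #Kept owner S)                               ≡⟨ Ex-cong (λ S → ∏-if (λ i → Kept owner i S) ½) ⟨
    Ex (λ S → ∏ (λ i → if Kept owner i S then ½ else 1ℚ))      ≡⟨ Ex-∏-Kept owner (λ _ → ½) ⟩
    ∏ (λ i → 1ℚ - p ^ℚ #owned owner i * ½)                     ≤⟨ ∏-mono-≤ factor-nonNeg factor≤ ⟩
    ∏ {k} (λ _ → 1ℚ - p ^ℚ R * ½)                              ≡⟨ ∏-const k (1ℚ - p ^ℚ R * ½) ⟩
    (1ℚ - p ^ℚ R * ½) ^ℚ k                                     ∎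
    where
    open ≤-Reasoning
    factor-nonNeg : ∀ i → 0ℚ ≤ 1ℚ - p ^ℚ #owned owner i * ½
    factor-nonNeg i = 0≤1-q^k*½ (#owned owner i) 0≤p p≤1
    factor≤ : ∀ i → 1ℚ - p ^ℚ #owned owner i * ½ ≤ 1ℚ - p ^ℚ R * ½
    factor≤ i = +-monoʳ-≤ 1ℚ (neg-antimono-≤ (*-monoʳ-≤-nonNeg ½ {{nonNegative 0≤½}} (^ℚ-antitone (#owned≤R i) 0≤p p≤1)))

module PathSystems {n} (G : Hypergraph3 n) (sts : IsSTS G) (𝒰 : SingletonPairPartition n) where

  open SubsetCounting
  open SteinerQuasigroup G sts
  open Ownership
  open import Data.Nat as ℕ using (ℕ; zero; suc; _+_; _*_; _≤_; _<_; z≤n; s≤s)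
  import Data.Nat.Properties as ℕ
  open import Data.Fin using (Fin; zero; suc)
  open import Data.Fin.Properties using (_≟_; any?)
  open import Data.Fin.Subset using (_∈_)
  open import Data.Vec using (tabulate)
  import Data.Vec.Properties as Vec
  open import Data.Maybe using (Maybe; just; nothing)
  open import Data.List using (List; []; _∷_; _++_; map; length; concatMap)
  import Data.List.Properties as List
  open import Data.List.Membership.Propositional using () renaming (_∈_ to _∈ₗ_; _∉_ to _∉ₗ_)
  open import Data.List.Membership.Propositional.Properties using (∈-++⁺ˡ; ∈-++⁺ʳ; ∈-map⁺; ∈-map⁻; ∈-concat⁺′)
  open import Data.List.Membership.DecPropositional (_≟_ {SingletonPairPartition.m 𝒰}) using () renaming (_∈?_ to _∈ₗ?_)
  open import Data.List.Relation.Unary.Any using (here; there)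
  open import Data.List.Relation.Unary.All as All using (All; []; _∷_)
  open import Data.List.Relation.Unary.All.Properties as All using (All¬⇒¬Any)
  open import Data.List.Relation.Unary.AllPairs using ([]; _∷_)
  open import Data.List.Relation.Unary.Unique.Propositional using (Unique)
  open import Data.Product using (Σ; ∃; _×_; _,_; proj₁; proj₂)
  open import Data.Sum using (inj₁; inj₂)
  open import Data.Empty using (⊥; ⊥-elim)
  open import Relation.Nullary using (yes; no; contradiction)
  open import Relation.Binary.PropositionalEquality
  open import Data.Bool using (true)
  open import Function using (_∘_)

  blockOf : Fin n → Fin (m 𝒰)
  blockOf x = proj₁ (covers 𝒰 x)

  ∈-blockOf : ∀ x → x ∈ block 𝒰 (blockOf x)
  ∈-blockOf x = proj₂ (covers 𝒰 x)

  blockmates : Fin n → List (Fin n)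
  blockmates x = elements (block 𝒰 (blockOf x))

  length-blockmates : ∀ x → length (blockmates x) ≤ 2
  length-blockmates x = subst (_≤ 2) (sym (length-elements (block 𝒰 (blockOf x)))) (small 𝒰 (blockOf x))

  ∈-blockmates : ∀ {x y} → blockOf y ≡ blockOf x → y ∈ₗ blockmates x
  ∈-blockmates {y = y} same = ∈-elements (subst (λ b → y ∈ block 𝒰 b) same (∈-blockOf y))

  private
    length-concatMap : ∀ {A B : Set} (f : A → List B) c → (∀ x → length (f x) ≤ c) →
                       ∀ xs → length (concatMap f xs) ≤ c * length xs
    length-concatMap f c bound []       = z≤n
    length-concatMap f c bound (x ∷ xs) = begin
      length (f x ++ concatMap f xs)          ≡⟨ List.length-++ (f x) ⟩
      length (f x) + length (concatMap f xs)  ≤⟨ ℕ.+-mono-≤ (bound x) (length-concatMap f c bound xs) ⟩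
      c + c * length xs                       ≡⟨ ℕ.*-suc c (length xs) ⟨
      c * suc (length xs)                     ∎
      where open ℕ.≤-Reasoning

  module _ (u v : Fin n) (u≢v : u ≢ v) where

    interior : Path3 G → List (Fin n)
    interior P = v1 P ∷ u1 P ∷ u2 P ∷ v2 P ∷ u3 P ∷ []

    internal⇒interior : ∀ (P : UVPath3 G u v) → v0 (path P) ≡ u → v3 (path P) ≡ v →
                        ∀ {x} → Internal P x → x ∈ₗ interior (path P)
    internal⇒interior P refl refl (here refl , x≢u , _)                                    = contradiction refl x≢u
    internal⇒interior P refl refl (there (here refl) , _)                                   = here refl
    internal⇒interior P refl refl (there (there (here refl)) , _)                           = there (there (there (here refl)))
    internal⇒interior P refl refl (there (there (there (here refl))) , _ , x≢v)             = contradiction refl x≢v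
    internal⇒interior P refl refl (there (there (there (there (here refl)))) , _)           = there (here refl)
    internal⇒interior P refl refl (there (there (there (there (there (here refl))))) , _)   = there (there (here refl))
    internal⇒interior P refl refl (there (there (there (there (there (there (here refl)))))) , _) =
      there (there (there (there (here refl))))

    record AvoidingPath (F : List (Fin n)) : Set where
      field
        route  : UVPath3 G u v
        starts : v0 (path route) ≡ u
        ends   : v3 (path route) ≡ v
        avoids : All (_∉ₗ F) (interior (path route))

    path-via : ∀ {w₁ w₂} → Unique (u ∷ w₁ ∷ w₂ ∷ v ∷ u · w₁ ∷ w₁ · w₂ ∷ w₂ · v ∷ []) → UVPath3 G u v
    path-via {w₁} {w₂} all-distinct@((u≢w₁ ∷ _) ∷ (w₁≢w₂ ∷ _) ∷ (w₂≢v ∷ _) ∷ _) = record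
      { path = record { v0 = u ; v1 = w₁ ; v2 = w₂ ; v3 = v ; u1 = u · w₁ ; u2 = w₁ · w₂ ; u3 = w₂ · v
                      ; distinct = all-distinct ; edge1 = ·-edge u≢w₁ ; edge2 = ·-edge w₁≢w₂ ; edge3 = ·-edge w₂≢v }
      ; endU = inj₁ refl
      ; endV = inj₂ refl
      }

    -- Every inequality the path needs is read off from w₁ and w₂ avoiding F, the earlier vertices
    -- and their images under u ·_, w₁ ·_ and v ·_ (via ·-avoids).
    mkAvoidingPath : ∀ {F w₁ w₂} →
      All (w₁ ≢_) (u ∷ v ∷ F) → All (λ y → w₁ ≢ u · y) (u ∷ v ∷ F) →
      All (w₂ ≢_) (w₁ ∷ u · w₁ ∷ u ∷ v ∷ F) →
      All (λ y → w₂ ≢ w₁ · y) (w₁ ∷ u · w₁ ∷ u ∷ v ∷ F) → All (λ y → w₂ ≢ v · y) (w₁ ∷ u · w₁ ∷ u ∷ v ∷ F) →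
      AvoidingPath F
    mkAvoidingPath {F} {w₁} {w₂}
      (w₁≢u ∷ w₁≢v ∷ w₁∉F) (_ ∷ w₁≢u·v ∷ w₁∉u·F)
      (w₂≢w₁ ∷ w₂≢a ∷ w₂≢u ∷ w₂≢v ∷ w₂∉F) (_ ∷ w₂≢w₁·a ∷ w₂≢w₁·u ∷ w₂≢w₁·v ∷ w₂∉w₁·F)
      (w₂≢v·w₁ ∷ w₂≢v·a ∷ w₂≢v·u ∷ _ ∷ w₂∉v·F) = record
      { route  = path-via all-distinct
      ; starts = refl
      ; ends   = refl
      ; avoids = ∉F w₁∉F ∷ ∉F (All.map (·-avoids u≢w₁) w₁∉u·F) ∷ ∉F (All.map (·-avoids w₁≢w₂) w₂∉w₁·F)
               ∷ ∉F w₂∉F ∷ ∉F (All.map c-avoids w₂∉v·F) ∷ []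
      }
      where
      ∉F : ∀ {x} → All (x ≢_) F → x ∉ₗ F
      ∉F = All¬⇒¬Any
      u≢w₁ = ≢-sym w₁≢u
      w₁≢w₂ = ≢-sym w₂≢w₁
      c-avoids : ∀ {y} → w₂ ≢ v · y → w₂ · v ≢ y
      c-avoids w₂≢v·y c≡y = ·-avoids (≢-sym w₂≢v) w₂≢v·y (trans (sym (·-comm w₂≢v)) c≡y)
      b≢c : w₁ · w₂ ≢ w₂ · v
      b≢c b≡c = w₁≢v (trans (sym (·-cancelʳ w₁≢w₂)) (trans (cong (w₂ ·_) b≡c) (·-cancelˡ w₂≢v)))
      all-distinct : Unique (u ∷ w₁ ∷ w₂ ∷ v ∷ u · w₁ ∷ w₁ · w₂ ∷ w₂ · v ∷ [])
      all-distinct =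
          (u≢w₁ ∷ ≢-sym w₂≢u ∷ u≢v ∷ ≢-sym (·-≢ˡ u≢w₁) ∷ ≢-sym (·-avoids w₁≢w₂ w₂≢w₁·u) ∷ ≢-sym (c-avoids w₂≢v·u) ∷ [])
        ∷ (w₁≢w₂ ∷ w₁≢v ∷ ≢-sym (·-≢ʳ u≢w₁) ∷ ≢-sym (·-≢ˡ w₁≢w₂) ∷ ≢-sym (c-avoids w₂≢v·w₁) ∷ [])
        ∷ (w₂≢v ∷ w₂≢a ∷ ≢-sym (·-≢ʳ w₁≢w₂) ∷ ≢-sym (·-≢ˡ w₂≢v) ∷ [])
        ∷ (≢-sym (·-avoids u≢w₁ w₁≢u·v) ∷ ≢-sym (·-avoids w₁≢w₂ w₂≢w₁·v) ∷ ≢-sym (·-≢ʳ w₂≢v) ∷ [])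
        ∷ (≢-sym (·-avoids w₁≢w₂ w₂≢w₁·a) ∷ ≢-sym (c-avoids w₂≢v·a) ∷ [])
        ∷ (b≢c ∷ [])
        ∷ [] ∷ []

    private
      length-++-map : ∀ (L : List (Fin n)) f → length (L ++ map f L) ≡ 2 * length L
      length-++-map L f rewrite List.length-++ L {map f L} | List.length-map f L =
        cong (length L +_) (sym (ℕ.+-identityʳ (length L)))

      length-++-map-map : ∀ (L : List (Fin n)) f g → length (L ++ map f L ++ map g L) ≡ 3 * length L
      length-++-map-map L f g
        rewrite List.length-++ L {map f L ++ map g L} | List.length-++ (map f L) {map g L}
              | List.length-map f L | List.length-map g L =
        cong (λ y → length L + (length L + y)) (sym (ℕ.+-identityʳ (length L)))

    opaque
      avoidingPath : ∀ F → 12 + 3 * length F < n → AvoidingPath F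
      avoidingPath F short = with-w₁ (∃-avoiding (F₁ ++ map (u ·_) F₁) length₁)
        where
        F₁ : List (Fin n)
        F₁ = u ∷ v ∷ F
        length₁ : length (F₁ ++ map (u ·_) F₁) < n
        length₁ = ℕ.≤-<-trans (begin
          length (F₁ ++ map (u ·_) F₁)  ≡⟨ length-++-map F₁ (u ·_) ⟩
          2 * (2 + length F)            ≤⟨ ℕ.*-mono-≤ (ℕ.n≤1+n 2) (ℕ.+-monoˡ-≤ (length F) (ℕ.m≤m+n 2 2)) ⟩
          3 * (4 + length F)            ≡⟨ ℕ.*-distribˡ-+ 3 4 (length F) ⟩
          12 + 3 * length F             ∎) short
          where open ℕ.≤-Reasoning
        with-w₁ : (∃ λ w₁ → All (w₁ ≢_) (F₁ ++ map (u ·_) F₁)) → AvoidingPath F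
        with-w₁ (w₁ , avoid₁) = with-w₂ (∃-avoiding (F₂ ++ map (w₁ ·_) F₂ ++ map (v ·_) F₂) length₂)
          where
          F₂ : List (Fin n)
          F₂ = w₁ ∷ u · w₁ ∷ F₁
          length₂ : length (F₂ ++ map (w₁ ·_) F₂ ++ map (v ·_) F₂) < n
          length₂ = subst (_< n) (sym (trans (length-++-map-map F₂ (w₁ ·_) (v ·_)) (ℕ.*-distribˡ-+ 3 4 (length F)))) short
          with-w₂ : (∃ λ w₂ → All (w₂ ≢_) (F₂ ++ map (w₁ ·_) F₂ ++ map (v ·_) F₂)) → AvoidingPath F
          with-w₂ (w₂ , avoid₂) with All.++⁻ F₁ avoid₁ | All.++⁻ F₂ avoid₂
          ... | w₁≁F₁ , w₁≁u·F₁ | w₂≁F₂ , w₂≁w₁·F₂++v·F₂ with All.++⁻ (map (w₁ ·_) F₂) w₂≁w₁·F₂++v·F₂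
          ... | w₂≁w₁·F₂ , w₂≁v·F₂ = mkAvoidingPath w₁≁F₁ (All.map⁻ w₁≁u·F₁) w₂≁F₂ (All.map⁻ w₂≁w₁·F₂) (All.map⁻ w₂≁v·F₂)

    record PathSystem (k : ℕ) : Set where
      field
        route            : Fin k → UVPath3 G u v
        support          : Fin k → List (Fin (m 𝒰))
        length-support   : ∀ i → length (support i) ≤ 5
        internal⇒support : ∀ i {x} → Internal (route i) x → blockOf x ∈ₗ support i
        support-disjoint : ∀ i j {b} → b ∈ₗ support i → b ∈ₗ support j → i ≡ j

    private
      add-route : ∀ {k} (𝒫 : PathSystem k) (P : UVPath3 G u v) (S : List (Fin (m 𝒰))) → length S ≤ 5 →
                  (∀ {x} → Internal P x → blockOf x ∈ₗ S) →
                  (∀ i {b} → b ∈ₗ S → b ∈ₗ PathSystem.support 𝒫 i → ⊥) → PathSystem (suc k)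
      add-route {k} 𝒫 P S length-S internal⇒S S-avoids = record
        { route            = route′
        ; support          = support′
        ; length-support   = length-support′
        ; internal⇒support = internal⇒support′
        ; support-disjoint = support-disjoint′
        }
        where
        open PathSystem 𝒫
        route′ : Fin (suc k) → UVPath3 G u v
        route′ zero    = P
        route′ (suc i) = route i
        support′ : Fin (suc k) → List (Fin (m 𝒰))
        support′ zero    = S
        support′ (suc i) = support i
        length-support′ : ∀ i → length (support′ i) ≤ 5
        length-support′ zero    = length-S
        length-support′ (suc i) = length-support i
        internal⇒support′ : ∀ i {x} → Internal (route′ i) x → blockOf x ∈ₗ support′ i
        internal⇒support′ zero    = internal⇒S
        internal⇒support′ (suc i) = internal⇒support i
        support-disjoint′ : ∀ i j {b} → b ∈ₗ support′ i → b ∈ₗ support′ j → i ≡ j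
        support-disjoint′ zero    zero    _   _   = refl
        support-disjoint′ zero    (suc j) b∈i b∈j = ⊥-elim (S-avoids j b∈i b∈j)
        support-disjoint′ (suc i) zero    b∈i b∈j = ⊥-elim (S-avoids i b∈j b∈i)
        support-disjoint′ (suc i) (suc j) b∈i b∈j = cong suc (support-disjoint i j b∈i b∈j)

      -- used covers every block of the supports, so a new path avoiding it is block-disjoint from them
      record Extendable (k : ℕ) : Set where
        field
          system      : PathSystem k
          used        : List (Fin n)
          length-used : length used ≤ 10 * k
          used-covers : ∀ i y → blockOf y ∈ₗ PathSystem.support system i → y ∈ₗ used

      extend : ∀ {k} (E : Extendable k) → 12 + 3 * length (Extendable.used E) < n → Extendable (suc k)
      extend {k} E short = record
        { system      = extended
        ; used        = concatMap blockmates new ++ used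
        ; length-used = length-used′
        ; used-covers = used-covers′
        }
        where
        open Extendable E
        open AvoidingPath (avoidingPath used short) renaming (route to new-route)
        new = interior (path new-route)
        new-avoids-old : ∀ i {b} → b ∈ₗ map blockOf new → b ∈ₗ PathSystem.support system i → ⊥
        new-avoids-old i b∈new b∈old with ∈-map⁻ blockOf b∈new
        ... | x , x∈new , refl = All.lookup avoids x∈new (used-covers i x b∈old)
        extended : PathSystem (suc k)
        extended = add-route system new-route (map blockOf new) (ℕ.≤-reflexive (List.length-map blockOf new))
                             (∈-map⁺ blockOf ∘ internal⇒interior new-route starts ends) new-avoids-old
        length-used′ : length (concatMap blockmates new ++ used) ≤ 10 * suc k
        length-used′ = begin
          length (concatMap blockmates new ++ used)         ≡⟨ List.length-++ (concatMap blockmates new) ⟩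
          length (concatMap blockmates new) + length used   ≤⟨ ℕ.+-mono-≤ (length-concatMap blockmates 2 length-blockmates new) length-used ⟩
          10 + 10 * k                                       ≡⟨ ℕ.*-suc 10 k ⟨
          10 * suc k                                        ∎
          where open ℕ.≤-Reasoning
        used-covers′ : ∀ i y → blockOf y ∈ₗ PathSystem.support extended i → y ∈ₗ concatMap blockmates new ++ used
        used-covers′ zero y y∈new with ∈-map⁻ blockOf y∈new
        ... | x , x∈new , same = ∈-++⁺ˡ (∈-concat⁺′ (∈-blockmates same) (∈-map⁺ blockmates x∈new))
        used-covers′ (suc i) y y∈i = ∈-++⁺ʳ _ (used-covers i y y∈i)

      grow : ∀ k → 30 * k ≤ n → Extendable k
      grow zero    _     = record
        { system      = record { route = λ () ; support = λ () ; length-support = λ ()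
                               ; internal⇒support = λ () ; support-disjoint = λ () }
        ; used        = []
        ; length-used = z≤n
        ; used-covers = λ ()
        }
      grow (suc k) 30k+30≤n = extend E short
        where
        E = grow k (ℕ.≤-trans (ℕ.*-monoʳ-≤ 30 (ℕ.n≤1+n k)) 30k+30≤n)
        short : 12 + 3 * length (Extendable.used E) < n
        short = begin-strict
          12 + 3 * length (Extendable.used E)  ≤⟨ ℕ.+-monoʳ-≤ 12 (ℕ.*-monoʳ-≤ 3 (Extendable.length-used E)) ⟩
          12 + 3 * (10 * k)                    ≡⟨ cong (12 +_) (ℕ.*-assoc 3 10 k) ⟨
          12 + 30 * k                          <⟨ ℕ.+-monoˡ-< (30 * k) (ℕ.s≤s (ℕ.m≤m+n 12 17)) ⟩
          30 + 30 * k                          ≡⟨ ℕ.*-suc 30 k ⟨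
          30 * suc k                           ≤⟨ 30k+30≤n ⟩
          n                                    ∎
          where open ℕ.≤-Reasoning

    pathSystem : ∀ k → 30 * k ≤ n → PathSystem k
    pathSystem k 30k≤n = Extendable.system (grow k 30k≤n)

    module _ {k} (𝒫 : PathSystem k) where

      open PathSystem 𝒫

      owner : Fin (m 𝒰) → Maybe (Fin k)
      owner b with any? (λ i → b ∈ₗ? support i)
      ... | yes (i , _) = just i
      ... | no  _       = nothing

      owner-support : ∀ {i b} → b ∈ₗ support i → owner b ≡ just i
      owner-support {i} {b} b∈i with any? (λ j → b ∈ₗ? support j)
      ... | yes (j , b∈j) = cong just (support-disjoint j i b∈j b∈i)
      ... | no  ∄j        = contradiction (i , b∈i) ∄j

      owner⇒support : ∀ {i b} → owner b ≡ just i → b ∈ₗ support i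
      owner⇒support {i} {b} owner≡i with any? (λ j → b ∈ₗ? support j) | owner≡i
      ... | yes (j , b∈j) | refl = b∈j

      #owned≤5 : ∀ i → #owned owner i ≤ 5
      #owned≤5 i = ℕ.≤-trans (∣p∣≤length (tabulate (λ b → owns (owner b) i)) (support i) owned⇒support) (length-support i)
        where
        owned⇒support : ∀ {b} → b ∈ tabulate (λ b → owns (owner b) i) → b ∈ₗ support i
        owned⇒support {b} b∈owned =
          owner⇒support (owns⇒≡just (trans (sym (Vec.lookup∘tabulate (λ b → owns (owner b) i) b)) (Vec.[]=⇒lookup b∈owned)))

      kept-routes : ∀ S → Σ (Fin (#Kept owner S) → UVPath3 G u v) λ P →
                          (∀ i j → i ≢ j → InternallyDisjoint (P i) (P j)) × (∀ i x → Internal (P i) x → InX 𝒰 S x)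
      kept-routes S = route ∘ enumerate kept , pairwise-disjoint , in-X
        where
        kept = tabulate (λ i → Kept owner i S)
        pairwise-disjoint : ∀ i j → i ≢ j → InternallyDisjoint (route (enumerate kept i)) (route (enumerate kept j))
        pairwise-disjoint i j i≢j x x-int-i x-int-j =
          i≢j (enumerate-injective kept (support-disjoint _ _ (internal⇒support _ x-int-i) (internal⇒support _ x-int-j)))
        in-X : ∀ i x → Internal (route (enumerate kept i)) x → InX 𝒰 S x
        in-X i x x-int = blockOf x , Kept⇒∈ owner (blockOf x) is-kept (owner-support (internal⇒support _ x-int)) , ∈-blockOf x
          where
          is-kept : Kept owner (enumerate kept i) S ≡ true
          is-kept = trans (sym (Vec.lookup∘tabulate (λ i → Kept owner i S) (enumerate kept i))) (Vec.[]=⇒lookup (enumerate-∈ kept i))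

module Parameters (d : ℕ) where

  open RationalArithmetic
  open import Data.Nat using (suc)
  import Data.Nat as ℕ
  import Data.Nat.Properties as ℕ
  open import Data.Nat.DivMod using (m/n*n≤m; m%n<n; m≡m%n+[m/n]*n)
  open import Data.Nat.Tactic.RingSolver using (solve-∀)
  import Data.Integer as ℤ
  open import Data.Rational hiding (_/_)
  open import Data.Rational.Properties
  open import Data.Rational.Solver using (module +-*-Solver)
  open import Relation.Binary.PropositionalEquality

  -- D · y = 1 for y = (1/(d+1))⁵/2. With t = ⌊n/K⌋, K = 60D + 1 ensures 30M ≤ n for the
  -- M = 2Dt paths and μn < t + 1 whenever μ ≤ 1/K.
  D K : ℕ
  D = 2 ℕ.* suc d ℕ.^ 5
  K = suc (60 ℕ.* D)

  private
    q y : ℚ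
    q = 1/[1+ d ]
    y = q ^ℚ 5 * ½

    0≤q : 0ℚ ≤ q
    0≤q = <⇒≤ (1/[1+k]-pos d)

    q≤1 : q ≤ 1ℚ
    q≤1 = *≤* (ℤ.+≤+ (ℕ.s≤s ℕ.z≤n))

    0≤y : 0ℚ ≤ y
    0≤y = *-nonNeg (^ℚ-nonNeg 5 0≤q) 0≤½

    y≤1 : y ≤ 1ℚ
    y≤1 = ≤-trans (*-mono-≤-nonNeg (^ℚ-nonNeg 5 0≤q) (^ℚ-≤1 5 0≤q q≤1) 0≤½ ½≤1) (≤-reflexive (*-identityˡ 1ℚ))

    D*y≡1 : ℕtoℚ D * y ≡ 1ℚ
    D*y≡1 = begin
      ℕtoℚ D * y                                         ≡⟨ cong (_* y) (trans (ℕtoℚ-* 2 (suc d ℕ.^ 5)) (cong (ℕtoℚ 2 *_) (ℕtoℚ-^ (suc d) 5))) ⟩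
      ℕtoℚ 2 * ℕtoℚ (suc d) ^ℚ 5 * (q ^ℚ 5 * ½)          ≡⟨ solve 4 (λ t a b h → t :* a :^ 5 :* (b :^ 5 :* h) := (t :* h) :* (b :* a) :^ 5) refl (ℕtoℚ 2) (ℕtoℚ (suc d)) q ½ ⟩
      (ℕtoℚ 2 * ½) * (q * ℕtoℚ (suc d)) ^ℚ 5              ≡⟨ cong (λ z → (ℕtoℚ 2 * ½) * z ^ℚ 5) (1/[1+k]*[1+k]≡1 d) ⟩
      1ℚ                                                  ∎
      where
      open ≡-Reasoning
      open +-*-Solver

    -- Bernoulli's inequality with D y = 1
    [1-y]^D≤½ : (1ℚ - y) ^ℚ D ≤ ½
    [1-y]^D≤½ = begin
      (1ℚ - y) ^ℚ D                         ≡⟨ solve 1 (λ a → a := (a :* (con 1ℚ :+ con 1ℚ)) :* con ½) refl ((1ℚ - y) ^ℚ D) ⟩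
      (1ℚ - y) ^ℚ D * (1ℚ + 1ℚ) * ½         ≡⟨ cong (λ z → (1ℚ - y) ^ℚ D * (1ℚ + z) * ½) D*y≡1 ⟨
      (1ℚ - y) ^ℚ D * (1ℚ + ℕtoℚ D * y) * ½ ≤⟨ *-monoʳ-≤-nonNeg ½ {{nonNegative 0≤½}} (bernoulli D y 0≤y y≤1) ⟩
      1ℚ * ½                                ≡⟨ *-identityˡ ½ ⟩
      ½                                     ∎
      where
      open ≤-Reasoning
      open +-*-Solver

  module Scale (n : ℕ) where

    t s M : ℕ
    t = n ℕ./ K
    s = suc t
    M = D ℕ.* (2 ℕ.* t)

    30M≤n : 30 ℕ.* M ℕ.≤ n
    30M≤n = begin
      30 ℕ.* (D ℕ.* (2 ℕ.* t))   ≡⟨ regroup D t ⟩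
      (60 ℕ.* D) ℕ.* t           ≤⟨ ℕ.*-monoˡ-≤ t (ℕ.n≤1+n (60 ℕ.* D)) ⟩
      K ℕ.* t                    ≡⟨ ℕ.*-comm K t ⟩
      t ℕ.* K                    ≤⟨ m/n*n≤m n K ⟩
      n                          ∎
      where
      open ℕ.≤-Reasoning
      regroup : ∀ D t → 30 ℕ.* (D ℕ.* (2 ℕ.* t)) ≡ (60 ℕ.* D) ℕ.* t
      regroup = solve-∀

    n<s*K : n ℕ.< s ℕ.* K
    n<s*K = begin-strict
      n                          ≡⟨ m≡m%n+[m/n]*n n K ⟩
      n ℕ.% K ℕ.+ t ℕ.* K        <⟨ ℕ.+-monoˡ-< (t ℕ.* K) (m%n<n n K) ⟩
      K ℕ.+ t ℕ.* K              ∎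
      where open ℕ.≤-Reasoning

    μn≤s : ∀ {μ} → 0ℚ ≤ μ → μ ≤ 1/[1+ 60 ℕ.* D ] → μ * ℕtoℚ n ≤ ℕtoℚ s
    μn≤s {μ} 0≤μ μ≤1/K = begin
      μ * ℕtoℚ n                          ≤⟨ *-mono-≤-nonNeg 0≤μ μ≤1/K (ℕtoℚ-nonNeg n) (ℕtoℚ-mono-≤ (ℕ.<⇒≤ n<s*K)) ⟩
      1/[1+ 60 ℕ.* D ] * ℕtoℚ (s ℕ.* K)   ≡⟨ cong (1/[1+ 60 ℕ.* D ] *_) (trans (ℕtoℚ-* s K) (*-comm (ℕtoℚ s) (ℕtoℚ K))) ⟩
      1/[1+ 60 ℕ.* D ] * (ℕtoℚ K * ℕtoℚ s) ≡⟨ *-assoc 1/[1+ 60 ℕ.* D ] (ℕtoℚ K) (ℕtoℚ s) ⟨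
      1/[1+ 60 ℕ.* D ] * ℕtoℚ K * ℕtoℚ s   ≡⟨ cong (_* ℕtoℚ s) (1/[1+k]*[1+k]≡1 (60 ℕ.* D)) ⟩
      1ℚ * ℕtoℚ s                         ≡⟨ *-identityˡ (ℕtoℚ s) ⟩
      ℕtoℚ s                              ∎
      where open ≤-Reasoning

    decay : ∀ {p} → 1/[1+ d ] ≤ p → p ≤ 1ℚ → (1ℚ - p ^ℚ 5 * ½) ^ℚ M ≤ ½ ^ℚ t * ½ ^ℚ t
    decay {p} q≤p p≤1 = begin
      (1ℚ - p ^ℚ 5 * ½) ^ℚ M         ≤⟨ ^ℚ-mono-≤ M (0≤1-q^k*½ 5 0≤p p≤1) 1-p⁵½≤1-y ⟩
      (1ℚ - y) ^ℚ M                  ≡⟨ ^ℚ-* (1ℚ - y) D (2 ℕ.* t) ⟩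
      ((1ℚ - y) ^ℚ D) ^ℚ (2 ℕ.* t)   ≤⟨ ^ℚ-mono-≤ (2 ℕ.* t) (^ℚ-nonNeg D (p≤q⇒0≤q-p y≤1)) [1-y]^D≤½ ⟩
      ½ ^ℚ (t ℕ.+ (t ℕ.+ 0))         ≡⟨ ^ℚ-+ ½ t (t ℕ.+ 0) ⟩
      ½ ^ℚ t * ½ ^ℚ (t ℕ.+ 0)        ≡⟨ cong (λ j → ½ ^ℚ t * ½ ^ℚ j) (ℕ.+-identityʳ t) ⟩
      ½ ^ℚ t * ½ ^ℚ t                ∎
      where
      open ≤-Reasoning
      0≤p = ≤-trans 0≤q q≤p
      1-p⁵½≤1-y : 1ℚ - p ^ℚ 5 * ½ ≤ 1ℚ - y
      1-p⁵½≤1-y = +-monoʳ-≤ 1ℚ (neg-antimono-≤ (*-monoʳ-≤-nonNeg ½ {{nonNegative 0≤½}} (^ℚ-mono-≤ 5 0≤q q≤p)))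

module TailBound (d e : ℕ) where

  open RationalArithmetic
  open Exponential using (cubic≤exp)
  open Parameters d using (K; module Scale)
  open import Data.Nat using (suc)
  import Data.Nat.Properties as ℕ
  open import Data.Nat.DivMod using (m*n/n≡m; /-monoˡ-≤)
  open import Data.Nat.Tactic.RingSolver using (solve-∀)
  open import Data.Rational hiding (_/_)
  open import Data.Rational.Properties
  open import Data.Rational.Solver using (module +-*-Solver)
  open import Relation.Binary.PropositionalEquality

  -- large enough that (e+1) · 2n³ ≤ 2^t for n ≥ N
  C N : ℕ
  C = 2 ℕ.* suc e ℕ.* K ℕ.^ 3
  N = 625 ℕ.* C ℕ.* K

  module _ (n : ℕ) where

    open Scale n

    private
      cubic≤2^t : N ℕ.≤ n → suc e ℕ.* (2 ℕ.* n ℕ.^ 3) ℕ.≤ 2 ℕ.^ t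
      cubic≤2^t N≤n = begin
        suc e ℕ.* (2 ℕ.* n ℕ.^ 3)          ≤⟨ ℕ.*-monoʳ-≤ (suc e) (ℕ.*-monoʳ-≤ 2 (ℕ.^-monoˡ-≤ 3 (ℕ.<⇒≤ n<s*K))) ⟩
        suc e ℕ.* (2 ℕ.* (s ℕ.* K) ℕ.^ 3)  ≡⟨ regroup (suc e) s K ⟩
        C ℕ.* s ℕ.^ 3                      ≤⟨ cubic≤exp C t 625C≤t ⟩
        2 ℕ.^ t                            ∎
        where
        open ℕ.≤-Reasoning
        regroup : ∀ E S K → E ℕ.* (2 ℕ.* (S ℕ.* K ℕ.* (S ℕ.* K ℕ.* (S ℕ.* K ℕ.* 1))))
                            ≡ 2 ℕ.* E ℕ.* (K ℕ.* (K ℕ.* (K ℕ.* 1))) ℕ.* (S ℕ.* (S ℕ.* (S ℕ.* 1)))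
        regroup = solve-∀
        625C≤t : 625 ℕ.* C ℕ.≤ t
        625C≤t = subst (ℕ._≤ t) (m*n/n≡m (625 ℕ.* C) K) (/-monoˡ-≤ K N≤n)

      2n³≤2^t/[1+e] : N ℕ.≤ n → ℕtoℚ (2 ℕ.* n ℕ.^ 3) ≤ 1/[1+ e ] * ℕtoℚ (2 ℕ.^ t)
      2n³≤2^t/[1+e] N≤n = begin
        ℕtoℚ (2 ℕ.* n ℕ.^ 3)                             ≡⟨ *-identityˡ _ ⟨
        1ℚ * ℕtoℚ (2 ℕ.* n ℕ.^ 3)                        ≡⟨ cong (_* ℕtoℚ (2 ℕ.* n ℕ.^ 3)) (1/[1+k]*[1+k]≡1 e) ⟨
        1/[1+ e ] * ℕtoℚ (suc e) * ℕtoℚ (2 ℕ.* n ℕ.^ 3)  ≡⟨ *-assoc 1/[1+ e ] (ℕtoℚ (suc e)) _ ⟩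
        1/[1+ e ] * (ℕtoℚ (suc e) * ℕtoℚ (2 ℕ.* n ℕ.^ 3)) ≡⟨ cong (1/[1+ e ] *_) (ℕtoℚ-* (suc e) (2 ℕ.* n ℕ.^ 3)) ⟨
        1/[1+ e ] * ℕtoℚ (suc e ℕ.* (2 ℕ.* n ℕ.^ 3))     ≤⟨ *-monoˡ-≤-nonNeg 1/[1+ e ] {{nonNegative (<⇒≤ (1/[1+k]-pos e))}}
                                                                               (ℕtoℚ-mono-≤ (cubic≤2^t N≤n)) ⟩
        1/[1+ e ] * ℕtoℚ (2 ℕ.^ t)                       ∎
        where open ≤-Reasoning

    tail-bound : N ℕ.≤ n → ∀ {p} → 1/[1+ d ] ≤ p → p ≤ 1ℚ →
                 ℕtoℚ n * (ℕtoℚ n * (ℕtoℚ n * (ℕtoℚ 2 ^ℚ s * (1ℚ - p ^ℚ 5 * ½) ^ℚ M))) ≤ 1/[1+ e ]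
    tail-bound N≤n {p} q≤p p≤1 = begin
      n′ * (n′ * (n′ * (ℕtoℚ 2 ^ℚ s * (1ℚ - p ^ℚ 5 * ½) ^ℚ M)))
        ≤⟨ n′*-mono (n′*-mono (n′*-mono (*-monoˡ-≤-nonNeg (ℕtoℚ 2 ^ℚ s) {{nonNegative (^ℚ-nonNeg s (ℕtoℚ-nonNeg 2))}} (decay q≤p p≤1)))) ⟩
      n′ * (n′ * (n′ * (ℕtoℚ 2 ^ℚ s * (½ ^ℚ t * ½ ^ℚ t))))
        ≡⟨ solve 4 (λ N two b a → N :* (N :* (N :* ((two :* b) :* (a :* a)))) := (two :* N :^ 3) :* a :* (b :* a))
                 refl n′ (ℕtoℚ 2) (ℕtoℚ 2 ^ℚ t) (½ ^ℚ t) ⟩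
      ℕtoℚ 2 * n′ ^ℚ 3 * ½ ^ℚ t * (ℕtoℚ 2 ^ℚ t * ½ ^ℚ t)
        ≡⟨ cong₂ (λ x z → x * ½ ^ℚ t * z) 2n³-≡ (sym (2^k*½^k≡1 t)) ⟨
      ℕtoℚ (2 ℕ.* n ℕ.^ 3) * ½ ^ℚ t * 1ℚ
        ≡⟨ *-identityʳ _ ⟩
      ℕtoℚ (2 ℕ.* n ℕ.^ 3) * ½ ^ℚ t
        ≤⟨ *-monoʳ-≤-nonNeg (½ ^ℚ t) {{nonNegative (^ℚ-nonNeg t 0≤½)}} (2n³≤2^t/[1+e] N≤n) ⟩
      1/[1+ e ] * ℕtoℚ (2 ℕ.^ t) * ½ ^ℚ t
        ≡⟨ trans (*-assoc 1/[1+ e ] (ℕtoℚ (2 ℕ.^ t)) (½ ^ℚ t)) (cong (λ z → 1/[1+ e ] * (z * ½ ^ℚ t)) (ℕtoℚ-^ 2 t)) ⟩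
      1/[1+ e ] * (ℕtoℚ 2 ^ℚ t * ½ ^ℚ t)
        ≡⟨ trans (cong (1/[1+ e ] *_) (2^k*½^k≡1 t)) (*-identityʳ 1/[1+ e ]) ⟩
      1/[1+ e ]
        ∎
      where
      open ≤-Reasoning
      open +-*-Solver
      n′ = ℕtoℚ n
      n′*-mono : ∀ {a b} → a ≤ b → n′ * a ≤ n′ * b
      n′*-mono = *-monoˡ-≤-nonNeg n′ {{nonNegative (ℕtoℚ-nonNeg n)}}
      2n³-≡ : ℕtoℚ (2 ℕ.* n ℕ.^ 3) ≡ ℕtoℚ 2 * n′ ^ℚ 3
      2n³-≡ = trans (ℕtoℚ-* 2 (n ℕ.^ 3)) (cong (ℕtoℚ 2 *_) (ℕtoℚ-^ n 3))

module FailureBound {n} (G : Hypergraph3 n) (sts : IsSTS G) (𝒰 : SingletonPairPartition n)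
                    (p : ℚ) (0≤p : 0ℚ ℚ.≤ p) (p≤1 : p ℚ.≤ 1ℚ)
                    (M : ℕ) (30M≤n : 30 ℕ.* M ℕ.≤ n) (s : ℕ) where

  open RationalArithmetic
  open FiniteSums
  open Ownership
  open ProductMeasure p 0≤p p≤1
  open PathSystems G sts 𝒰
  import Data.Nat.Properties as ℕ
  open import Data.Fin using (Fin)
  open import Data.Fin.Properties using (_≟_; any?)
  open import Data.Fin.Subset using (Subset)
  open import Data.Maybe using (Maybe)
  open import Data.List using (map)
  open import Data.Product using (Σ; ∃₂; _×_; _,_)
  open import Data.Empty using (⊥; ⊥-elim)
  open import Data.Rational hiding (_≟_)
  open import Data.Rational.Properties hiding (_≟_)
  open import Relation.Nullary using (¬_; Dec; yes; no)
  open import Relation.Unary using (Decidable)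
  open import Function using (_∘_)
  open import Relation.Binary.PropositionalEquality

  ownerOf : ∀ {u v} → u ≢ v → Fin (m 𝒰) → Maybe (Fin M)
  ownerOf {u} {v} u≢v = owner u v u≢v (pathSystem u v u≢v M 30M≤n)

  -- Pairs are indexed by the decision u ≟ v, so that Bad and penalty split on the same proof of u ≢ v.
  FewKept : ∀ u v → Dec (u ≡ v) → Subset (m 𝒰) → Set
  FewKept u v (yes _)  S = ⊥
  FewKept u v (no u≢v) S = #Kept (ownerOf u≢v) S ℕ.< s

  few-kept? : ∀ u v d S → Dec (FewKept u v d S)
  few-kept? u v (yes _)  S = no λ ()
  few-kept? u v (no u≢v) S = #Kept (ownerOf u≢v) S ℕ.<? s

  Bad : Subset (m 𝒰) → Set
  Bad S = ∃₂ λ u v → FewKept u v (u ≟ v) S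

  bad? : Decidable Bad
  bad? S = any? λ u → any? λ v → few-kept? u v (u ≟ v) S

  -- exponential moment: 2^s · 2^(-Y) ≥ 1 whenever Y < s
  penalty : ∀ u v → Dec (u ≡ v) → Subset (m 𝒰) → ℚ
  penalty u v (yes _)  S = 0ℚ
  penalty u v (no u≢v) S = ℕtoℚ 2 ^ℚ s * ½ ^ℚ #Kept (ownerOf u≢v) S

  penalty-nonNeg : ∀ u v d S → 0ℚ ≤ penalty u v d S
  penalty-nonNeg u v (yes _)  S = ≤-refl
  penalty-nonNeg u v (no u≢v) S = *-nonNeg (^ℚ-nonNeg s (ℕtoℚ-nonNeg 2)) (^ℚ-nonNeg (#Kept (ownerOf u≢v) S) 0≤½)

  B : ℚ
  B = ℕtoℚ 2 ^ℚ s * (1ℚ - p ^ℚ 5 * ½) ^ℚ M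

  Ex-penalty≤B : ∀ u v d → Ex (penalty u v d) ≤ B
  Ex-penalty≤B u v (yes _)  = subst (_≤ B) (sym (Ex-0 {m 𝒰})) (*-nonNeg (^ℚ-nonNeg s (ℕtoℚ-nonNeg 2)) (^ℚ-nonNeg M (0≤1-q^k*½ 5 0≤p p≤1)))
  Ex-penalty≤B u v (no u≢v) = begin
    Ex (λ S → ℕtoℚ 2 ^ℚ s * ½ ^ℚ #Kept (ownerOf u≢v) S)  ≡⟨ Ex-* (ℕtoℚ 2 ^ℚ s) (λ S → ½ ^ℚ #Kept (ownerOf u≢v) S) ⟩
    ℕtoℚ 2 ^ℚ s * Ex (λ S → ½ ^ℚ #Kept (ownerOf u≢v) S)  ≤⟨ *-monoˡ-≤-nonNeg (ℕtoℚ 2 ^ℚ s) {{nonNegative (^ℚ-nonNeg s (ℕtoℚ-nonNeg 2))}}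
                                                               (Ex-½^#Kept≤ (ownerOf u≢v) 5 (#owned≤5 u v u≢v _)) ⟩
    B                                                     ∎
    where open ≤-Reasoning

  𝟙[Bad]≤∑penalty : ∀ S → 𝟙 (bad? S) ≤ ∑ (λ u → ∑ (λ v → penalty u v (u ≟ v) S))
  𝟙[Bad]≤∑penalty S with bad? S
  ... | no  _              = ∑-nonNeg (λ u → ∑-nonNeg (λ v → penalty-nonNeg u v (u ≟ v) S))
  ... | yes (u , v , few)  = begin
    1ℚ                                               ≤⟨ few-kept⇒1≤penalty u v (u ≟ v) few ⟩
    penalty u v (u ≟ v) S                            ≤⟨ term≤∑ (λ v → penalty-nonNeg u v (u ≟ v) S) v ⟩
    ∑ (λ v → penalty u v (u ≟ v) S)                  ≤⟨ term≤∑ (λ u → ∑-nonNeg (λ v → penalty-nonNeg u v (u ≟ v) S)) u ⟩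
    ∑ (λ u → ∑ (λ v → penalty u v (u ≟ v) S))        ∎
    where
    open ≤-Reasoning
    few-kept⇒1≤penalty : ∀ u v d → FewKept u v d S → 1ℚ ≤ penalty u v d S
    few-kept⇒1≤penalty u v (no u≢v) few = 1≤2^s*½^k few

  P[Bad]≤ : Ex (λ S → 𝟙 (bad? S)) ≤ ℕtoℚ n * (ℕtoℚ n * B)
  P[Bad]≤ = begin
    Ex (λ S → 𝟙 (bad? S))                                  ≤⟨ Ex-mono-≤ 𝟙[Bad]≤∑penalty ⟩
    Ex (λ S → ∑ (λ u → ∑ (λ v → penalty u v (u ≟ v) S)))   ≡⟨ Ex-∑ (λ u S → ∑ (λ v → penalty u v (u ≟ v) S)) ⟩
    ∑ (λ u → Ex (λ S → ∑ (λ v → penalty u v (u ≟ v) S)))   ≡⟨ ∑-cong (λ u → Ex-∑ (λ v → penalty u v (u ≟ v))) ⟩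
    ∑ (λ u → ∑ (λ v → Ex (penalty u v (u ≟ v))))           ≤⟨ ∑-mono-≤ (λ u → ∑-mono-≤ (λ v → Ex-penalty≤B u v (u ≟ v))) ⟩
    ∑ {n} (λ _ → ∑ {n} (λ _ → B))                          ≡⟨ trans (∑-const n _) (cong (ℕtoℚ n *_) (∑-const n B)) ⟩
    ℕtoℚ n * (ℕtoℚ n * B)                                  ∎
    where open ≤-Reasoning

  ¬Bad⇒GoodEvent : ∀ {μ} → μ * ℕtoℚ n ≤ ℕtoℚ s → ∀ S → ¬ Bad S → GoodEvent G 𝒰 μ S
  ¬Bad⇒GoodEvent {μ} μn≤s S ¬bad u v u≢v = good-pair (u ≟ v) (λ few → ¬bad (u , v , few))
    where
    good-pair : (d : Dec (u ≡ v)) → ¬ FewKept u v d S →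
                Σ ℕ λ k → (μ * ℕtoℚ n ≤ ℕtoℚ k) ×
                  Σ (Fin k → UVPath3 G u v) λ P →
                    (∀ i j → i ≢ j → InternallyDisjoint (P i) (P j)) × (∀ i x → Internal (P i) x → InX 𝒰 S x)
    good-pair (yes u≡v)  _    = ⊥-elim (u≢v u≡v)
    good-pair (no  u≢v′) ¬few =
      #Kept (ownerOf u≢v′) S , ≤-trans μn≤s (ℕtoℚ-mono-≤ (ℕ.≮⇒≥ ¬few)) , kept-routes u v u≢v′ (pathSystem u v u≢v′ M 30M≤n) S

  failure : ∀ {μ ε} → μ * ℕtoℚ n ≤ ℕtoℚ s → ℕtoℚ n * (ℕtoℚ n * (ℕtoℚ n * B)) ≤ ε →
            FailureProbAtMostεOverN G 𝒰 p μ ε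
  failure {μ} {ε} μn≤s n³B≤ε = outcomes bad? , (λ S S∉ → ¬Bad⇒GoodEvent {μ} μn≤s S (S∉ ∘ ∈-outcomes bad?)) , (begin
    ℕtoℚ n * sumℚ (map (weight p) (outcomes bad?))  ≡⟨ cong (ℕtoℚ n *_) (total-weight-outcomes bad?) ⟩
    ℕtoℚ n * Ex (λ S → 𝟙 (bad? S))                 ≤⟨ *-monoˡ-≤-nonNeg (ℕtoℚ n) {{nonNegative (ℕtoℚ-nonNeg n)}} P[Bad]≤ ⟩
    ℕtoℚ n * (ℕtoℚ n * (ℕtoℚ n * B))               ≤⟨ n³B≤ε ⟩
    ε                                               ∎)
    where open ≤-Reasoning

-- opened only here: the modules above use ℕ's _≤_ and _<_ unqualified
open import Data.Nat using (ℕ; NonZero)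
open import Data.Rational using (ℚ; _≤_; _<_; _*_; 0ℚ; 1ℚ)
open import Data.Rational.Properties using (<⇒≤; ≤-trans)
open import Data.Product using (Σ; _×_; _,_)
open RationalArithmetic using (1/[1+_]; 1/[1+k]-pos; 1/denominator≤)

threshold : ℚ → ℚ
threshold p = 1/[1+ 60 ℕ.* Parameters.D (ℚ.denominator-1 p) ]

lemma4p4 : Σ (ℚ → ℚ) λ f →
    (∀ p → 0ℚ < p → p ≤ 1ℚ → 0ℚ < f p) ×
    (∀ p → 0ℚ < p → p ≤ 1ℚ →
     ∀ μ → 0ℚ < μ → μ ≤ f p →
     ∀ ε → 0ℚ < ε →
     Σ ℕ λ N → ∀ n → N Data.Nat.≤ n →
       (G : Hypergraph3 n) → IsSTS G →
       (𝒰 : SingletonPairPartition n) →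
       FailureProbAtMostεOverN G 𝒰 p μ ε)
lemma4p4 = threshold , (λ _ _ _ → 1/[1+k]-pos _) ,
  λ p 0<p p≤1 μ 0<μ μ≤threshold ε 0<ε →
    let open TailBound (ℚ.denominator-1 p) (ℚ.denominator-1 ε) in
    N , λ n N≤n G sts 𝒰 →
      let open Parameters.Scale (ℚ.denominator-1 p) n in
      FailureBound.failure G sts 𝒰 p (<⇒≤ 0<p) p≤1 M 30M≤n s {μ}
        (μn≤s (<⇒≤ 0<μ) μ≤threshold)
        (≤-trans (tail-bound n N≤n (1/denominator≤ p 0<p) p≤1) (1/denominator≤ ε 0<ε))
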